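{- Fix an integer $d>0$ and let $p=\frac{d}{d+1}$. For each $n\ge d+1$ let $\pi_n$ be chosen uniformly at random from the permutations $\pi\in S_n$ with $\mathrm{Des}(\pi)=d$. Then the total variation distance between the distribution of $\pi_n(1)$ and the geometric distribution on $\{1,2,\dots\}$ with probabilities $(1-p)p^{k-1}$ ($k\ge 1$) tends to $0$ as $n\to\infty$.
   Context: $S_n$ is the set of permutations of $\{1,\dots,n\}$. A descent of $\pi\in S_n$ is an index $i$ with $1\le i\le n-1$ and $\pi(i)>\pi(i+1)$; $\mathrm{Des}(\pi)$ is the number of descents of $\pi$. -}

module Defs where

open import Data.Nat as ℕ using (ℕ; zero; suc; _<ᵇ_)
open import Data.Bool using (Bool; true; false; if_then_else_)
open import Data.List using (List; []; _∷_; filter; length; map; concatMap; upTo)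
open import Data.List.Relation.Unary.Unique.DecPropositional ℕ._≟_ using (unique?)
open import Data.Integer using (+_)
open import Data.Rational using (ℚ; _/_; _+_; _-_; _*_; ∣_∣; 0ℚ; 1ℚ)
open import Relation.Nullary.Decidable using (⌊_⌋)
open import Data.Nat.Properties using (_≟_)

words : ℕ → List ℕ → List (List ℕ)
words zero    xs = [] ∷ []
words (suc m) xs = concatMap (λ x → map (x ∷_) (words m xs)) xs

-- S_n : permutations of {1,…,n} in one-line notation [π(1), …, π(n)],
-- i.e. words of length n over {1,…,n} with pairwise distinct letters
perms : ℕ → List (List ℕ)
perms n = filter (λ w → unique? w) (words n (map suc (upTo n)))

des : List ℕ → ℕ
des []           = 0
des (x ∷ [])     = 0
des (x ∷ y ∷ xs) = (if y <ᵇ x then 1 else 0) ℕ.+ des (y ∷ xs)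

-- first value π(1) (0 for the empty word, never used for n ≥ 1)
first : List ℕ → ℕ
first []      = 0
first (x ∷ _) = x

permsDes : ℕ → ℕ → List (List ℕ)
permsDes n d = filter (λ π → des π ≟ d) (perms n)

-- c / t as a rational (0 if t = 0; t > 0 whenever used)
frac : ℕ → ℕ → ℚ
frac c zero    = 0ℚ
frac c (suc t) = (+ c) / suc t

probFirst : ℕ → ℕ → ℕ → ℚ
probFirst d n k =
  frac (length (filter (λ π → first π ≟ k) (permsDes n d))) (length (permsDes n d))

_^ℚ_ : ℚ → ℕ → ℚ
q ^ℚ zero  = 1ℚ
q ^ℚ suc m = q * (q ^ℚ m)

geom : ℕ → ℕ → ℚ
geom d zero    = 0ℚ
geom d (suc k) = (1ℚ - p) * (p ^ℚ k)
  where p = (+ d) / suc d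

absDiffSum : ℕ → ℕ → ℕ → ℚ
absDiffSum d n zero    = 0ℚ
absDiffSum d n (suc M) = absDiffSum d n M + ∣ probFirst d n (suc M) - geom d (suc M) ∣

-- A word w over {1, …, d + 1} of length n gives the permutation `toPerm d w` that lists the
-- positions of the letter 1 in w, then those of the letter 2, and so on; its first value is the
-- position of the first 1 in w.  If w is good (for each a ≤ d some letter a + 1 occurs before
-- some letter a), the blocks of positions are exactly the ascending runs of `toPerm d w`, so
-- `toPerm d` is injective on good words and they land among the permutations with d descents.
-- Conversely a permutation with d descents has d + 1 ascending runs and is `toPerm d` of the word
-- recording the run of each value.  Hence, for every k, the number of permutations with d descents
-- and π(1) = k lies between the numbers of good words and of all words whose first 1 is at
-- position k.  There are at most d (n + 1) dⁿ bad words, negligible against (d + 1)ⁿ, and the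
-- position of the first 1 in a uniformly random word is geometric with parameter d / (d + 1)
-- up to the tail (d / (d + 1))ⁿ.
module Submission where

open import Data.Nat as ℕ
  using (ℕ; zero; suc; _+_; _*_; _∸_; _^_; _≤_; _<_; z≤n; s≤s; z<s; _≡ᵇ_; _<ᵇ_; NonZero; >-nonZero⁻¹)
open import Data.Nat.Properties
open import Data.Nat.Solver using (module +-*-Solver)
open import Data.Bool using (Bool; true; false; if_then_else_; not; _∧_; _∨_; T)
open import Data.Bool.Properties using (T-≡; T-∧; ∧-identityʳ)
open import Data.Bool.ListAction using (all; any)
open import Data.List using (List; []; _∷_; _++_; map; concat; concatMap; length; filter; filterᵇ; upTo; applyUpTo)
open import Data.List.Properties using (length-map; ∷-injective; map-cong; map-cong-local; filter-≐)
open import Data.List.Membership.Propositional using (_∈_; _∉_; find; lose)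
open import Data.List.Membership.Propositional.Properties
open import Data.List.Membership.DecPropositional ℕ._≟_ using (_∈?_)
open import Data.List.Relation.Binary.Subset.Propositional using (_⊆_)
open import Data.List.Relation.Binary.Permutation.Propositional
  using (_↭_; prep; ↭-reflexive; ↭-sym; ↭-trans; ↭⇒↭ₛ)
open import Data.List.Relation.Binary.Permutation.Propositional.Properties using (++⁺ˡ; shift; ∈-resp-↭; ↭-length)
import Data.List.Relation.Binary.Permutation.Setoid.Properties as ↭ₛ
open import Data.List.Relation.Unary.Any using (here; there)
open import Data.List.Relation.Unary.All as All using (All; []; _∷_)
import Data.List.Relation.Unary.All.Properties as All
open import Data.List.Relation.Unary.AllPairs as AllPairs using ([]; _∷_)
open import Data.List.Relation.Unary.Linked as Linked using (Linked; []; [-]; _∷_)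
import Data.List.Relation.Unary.Linked.Properties as Linkedₚ
open import Data.List.Relation.Unary.Unique.Propositional using (Unique)
import Data.List.Relation.Unary.Unique.Propositional.Properties as Unique
open import Data.List.Relation.Unary.Unique.DecPropositional ℕ._≟_ using (unique?)
open import Data.Product using (Σ; _×_; _,_; proj₁; proj₂)
open import Data.Sum using (_⊎_; inj₁; inj₂)
open import Data.Empty using (⊥; ⊥-elim)
open import Data.Empty.Irrelevant using () renaming (⊥-elim to ⊥-elim-irrelevant)
open import Data.Unit using (⊤; tt)
open import Function using (_∘_; id; Equivalence)
open import Relation.Binary.Definitions using (tri<; tri≈; tri>)
open import Relation.Binary.PropositionalEquality
open import Relation.Nullary using (Dec; yes; no; does)
open import Relation.Nullary.Decidable using (T?)
import Data.Integer as ℤ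
import Data.Integer.Properties as ℤₚ
open import Data.Integer.Solver using () renaming (module +-*-Solver to ℤ-Solver)
open import Data.Rational as ℚ using (ℚ; 0ℚ; 1ℚ; ∣_∣; toℚᵘ)
import Data.Rational.Properties as ℚₚ
open import Data.Rational.Solver using () renaming (module +-*-Solver to ℚ-Solver)
open import Data.Rational.Unnormalised as ℚᵘ using (mkℚᵘ; *≡*; *≤*)
import Data.Rational.Unnormalised.Properties as ℚᵘₚ
open import Algebra.Bundles using (CommutativeMonoid)
import Algebra.Properties.CommutativeSemigroup as CommutativeSemigroupProperties
open CommutativeSemigroupProperties +-commutativeSemigroup
  using () renaming (interchange to +-interchange; x∙yz≈y∙xz to +-leftComm)
open CommutativeSemigroupProperties (CommutativeMonoid.commutativeSemigroup ℚₚ.+-0-commutativeMonoid)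
  using () renaming (interchange to +-interchangeℚ)
open import Defs

private
  variable
    A B : Set

≡ᵇ-refl : ∀ x → (x ≡ᵇ x) ≡ true
≡ᵇ-refl x = Equivalence.to T-≡ (≡⇒≡ᵇ x x refl)

≡ᵇ≡true⇒≡ : ∀ {x y} → (x ≡ᵇ y) ≡ true → x ≡ y
≡ᵇ≡true⇒≡ {x} {y} eq = ≡ᵇ⇒≡ x y (Equivalence.from T-≡ eq)

≡ᵇ≡false⇒≢ : ∀ {x y} → (x ≡ᵇ y) ≡ false → x ≢ y
≡ᵇ≡false⇒≢ {x} eq refl = subst T eq (≡⇒≡ᵇ x x refl)

<⇒<ᵇ≡true : ∀ {x y} → x < y → (x <ᵇ y) ≡ true
<⇒<ᵇ≡true x<y = Equivalence.to T-≡ (<⇒<ᵇ x<y)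

≤⇒<ᵇ≡false : ∀ {x y} → x ≤ y → (y <ᵇ x) ≡ false
≤⇒<ᵇ≡false {x} {y} x≤y with y <ᵇ x in y<ᵇx
... | true  = ⊥-elim (<⇒≱ (<ᵇ⇒< y x (Equivalence.from T-≡ y<ᵇx)) x≤y)
... | false = refl

≢⇒≡ᵇ≡false : ∀ {x y} → x ≢ y → (x ≡ᵇ y) ≡ false
≢⇒≡ᵇ≡false {x} {y} x≢y with x ≡ᵇ y in eq
... | true  = ⊥-elim (x≢y (≡ᵇ≡true⇒≡ eq))
... | false = refl

-- Counting

indicator : Bool → ℕ
indicator true  = 1
indicator false = 0

count : (A → Bool) → List A → ℕ
count p []       = 0
count p (x ∷ xs) = indicator (p x) + count p xs

sumMap : (A → ℕ) → List A → ℕ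
sumMap f []       = 0
sumMap f (x ∷ xs) = f x + sumMap f xs

length-filter≡count : {P : A → Set} (P? : ∀ x → Dec (P x)) (xs : List A) →
  length (filter P? xs) ≡ count (does ∘ P?) xs
length-filter≡count P? []       = refl
length-filter≡count P? (x ∷ xs) with does (P? x)
... | true  = cong suc (length-filter≡count P? xs)
... | false = length-filter≡count P? xs

length≡count-true : (xs : List A) → length xs ≡ count (λ _ → true) xs
length≡count-true []       = refl
length≡count-true (x ∷ xs) = cong suc (length≡count-true xs)

count-++ : (p : A → Bool) (xs ys : List A) → count p (xs ++ ys) ≡ count p xs + count p ys
count-++ p []       ys = refl
count-++ p (x ∷ xs) ys = trans (cong (indicator (p x) +_) (count-++ p xs ys)) (sym (+-assoc (indicator (p x)) _ _))

count-map : (p : B → Bool) (f : A → B) (xs : List A) → count p (map f xs) ≡ count (p ∘ f) xs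
count-map p f []       = refl
count-map p f (x ∷ xs) = cong (indicator (p (f x)) +_) (count-map p f xs)

count-concatMap : (p : B → Bool) (f : A → List B) (xs : List A) →
  count p (concatMap f xs) ≡ sumMap (λ x → count p (f x)) xs
count-concatMap p f []       = refl
count-concatMap p f (x ∷ xs) =
  trans (count-++ p (f x) (concatMap f xs)) (cong (count p (f x) +_) (count-concatMap p f xs))

count-cong : (p q : A → Bool) (xs : List A) → (∀ x → x ∈ xs → p x ≡ q x) → count p xs ≡ count q xs
count-cong p q []       e = refl
count-cong p q (x ∷ xs) e = cong₂ _+_ (cong indicator (e x (here refl))) (count-cong p q xs (λ y → e y ∘ there))

count-false : (p : A → Bool) (xs : List A) → (∀ x → x ∈ xs → p x ≡ false) → count p xs ≡ 0
count-false p xs e = trans (count-cong p (λ _ → false) xs e) (zero≡ xs)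
  where
  zero≡ : (ys : List A) → count (λ _ → false) ys ≡ 0
  zero≡ []       = refl
  zero≡ (_ ∷ ys) = zero≡ ys

count-split : (q p : A → Bool) (xs : List A) →
  count p xs ≡ count (λ x → q x ∧ p x) xs + count (λ x → not (q x) ∧ p x) xs
count-split q p []       = refl
count-split q p (x ∷ xs) with q x | p x
... | true  | true  = cong suc (count-split q p xs)
... | true  | false = count-split q p xs
... | false | true  = trans (cong suc (count-split q p xs)) (sym (+-suc _ _))
... | false | false = count-split q p xs

count-not-∧ : (p q : A → Bool) (xs : List A) →
  count (λ x → not (p x ∧ q x)) xs ≤ count (not ∘ p) xs + count (not ∘ q) xs
count-not-∧ p q []       = z≤n
count-not-∧ p q (x ∷ xs) = begin
  indicator (not (p x ∧ q x)) + count (λ x → not (p x ∧ q x)) xs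
    ≤⟨ +-mono-≤ (indicator-not-∧ (p x) (q x)) (count-not-∧ p q xs) ⟩
  (indicator (not (p x)) + indicator (not (q x))) + (count (not ∘ p) xs + count (not ∘ q) xs)
    ≡⟨ +-interchange (indicator (not (p x))) _ _ _ ⟩
  (indicator (not (p x)) + count (not ∘ p) xs) + (indicator (not (q x)) + count (not ∘ q) xs) ∎
  where
  open ≤-Reasoning
  indicator-not-∧ : ∀ a b → indicator (not (a ∧ b)) ≤ indicator (not a) + indicator (not b)
  indicator-not-∧ true  b = ≤-refl
  indicator-not-∧ false b = s≤s z≤n

count-not-all : (P : B → A → Bool) (bs : List B) (xs : List A) →
  count (λ x → not (all (λ b → P b x) bs)) xs ≤ sumMap (λ b → count (λ x → not (P b x)) xs) bs
count-not-all P []       xs = ≤-reflexive (count-false _ xs (λ _ _ → refl))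
count-not-all P (b ∷ bs) xs =
  ≤-trans (count-not-∧ (P b) (λ x → all (λ b → P b x) bs) xs) (+-monoʳ-≤ _ (count-not-all P bs xs))

sumMap-cong : (f g : A → ℕ) (xs : List A) → (∀ x → x ∈ xs → f x ≡ g x) → sumMap f xs ≡ sumMap g xs
sumMap-cong f g []       e = refl
sumMap-cong f g (x ∷ xs) e = cong₂ _+_ (e x (here refl)) (sumMap-cong f g xs (λ y → e y ∘ there))

sumMap-mono-≤ : (f g : A → ℕ) (xs : List A) → (∀ x → x ∈ xs → f x ≤ g x) → sumMap f xs ≤ sumMap g xs
sumMap-mono-≤ f g []       e = z≤n
sumMap-mono-≤ f g (x ∷ xs) e = +-mono-≤ (e x (here refl)) (sumMap-mono-≤ f g xs (λ y → e y ∘ there))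

sumMap-const : (c : ℕ) (xs : List A) → sumMap (λ _ → c) xs ≡ length xs * c
sumMap-const c []       = refl
sumMap-const c (x ∷ xs) = cong (c +_) (sumMap-const c xs)

sumMap-≤-const : (f : A → ℕ) (xs : List A) {V : ℕ} → (∀ {x} → x ∈ xs → f x ≤ V) → sumMap f xs ≤ length xs * V
sumMap-≤-const f xs {V} f≤V = ≤-trans (sumMap-mono-≤ f (λ _ → V) xs (λ _ → f≤V)) (≤-reflexive (sumMap-const V xs))

-- `+ V` on the left stands in for `(length xs ∸ 1) * V` on the right.
sumMap-≤-except : ∀ (f : ℕ → ℕ) xs {b U V} → Unique xs → b ∈ xs → f b ≤ U → (∀ {x} → x ∈ xs → x ≢ b → f x ≤ V) →
  sumMap f xs + V ≤ U + length xs * V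
sumMap-≤-except f (x ∷ xs) {U = U} {V} (x∉ ∷ uxs) (here refl) fx≤U f≤V = begin
  (f x + sumMap f xs) + V    ≤⟨ +-monoˡ-≤ V (+-mono-≤ fx≤U (sumMap-≤-const f xs others≤V)) ⟩
  (U + length xs * V) + V    ≡⟨ +-assoc U _ V ⟩
  U + (length xs * V + V)    ≡⟨ cong (U +_) (+-comm _ V) ⟩
  U + length (x ∷ xs) * V    ∎
  where
  open ≤-Reasoning
  others≤V : ∀ {y} → y ∈ xs → f y ≤ V
  others≤V y∈ = f≤V (there y∈) (λ y≡x → All.lookup x∉ y∈ (sym y≡x))
sumMap-≤-except f (x ∷ xs) {b} {U} {V} (x∉ ∷ uxs) (there b∈) fb≤U f≤V = begin
  (f x + sumMap f xs) + V    ≤⟨ +-monoˡ-≤ V (+-monoˡ-≤ _ (f≤V (here refl) (λ x≡b → All.lookup x∉ b∈ x≡b))) ⟩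
  (V + sumMap f xs) + V      ≡⟨ +-assoc V _ V ⟩
  V + (sumMap f xs + V)      ≤⟨ +-monoʳ-≤ V (sumMap-≤-except f xs uxs b∈ fb≤U (f≤V ∘ there)) ⟩
  V + (U + length xs * V)    ≡⟨ +-leftComm V U _ ⟩
  U + length (x ∷ xs) * V    ∎
  where open ≤-Reasoning

-- f 1 + ⋯ + f M, summed in the same order as `absDiffSum`.
sumTo : ℕ → (ℕ → ℕ) → ℕ
sumTo zero    f = 0
sumTo (suc M) f = sumTo M f + f (suc M)

sumTo-zero : ∀ M → sumTo M (λ _ → 0) ≡ 0
sumTo-zero zero    = refl
sumTo-zero (suc M) = trans (+-identityʳ _) (sumTo-zero M)

sumTo-+ : ∀ M (f g : ℕ → ℕ) → sumTo M (λ k → f k + g k) ≡ sumTo M f + sumTo M g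
sumTo-+ zero    f g = refl
sumTo-+ (suc M) f g = trans (cong (_+ (f (suc M) + g (suc M))) (sumTo-+ M f g)) (+-interchange (sumTo M f) _ _ _)

sumTo-*ʳ : ∀ M (f : ℕ → ℕ) c → sumTo M (λ k → f k * c) ≡ sumTo M f * c
sumTo-*ʳ zero    f c = refl
sumTo-*ʳ (suc M) f c = trans (cong (_+ f (suc M) * c) (sumTo-*ʳ M f c)) (sym (*-distribʳ-+ c (sumTo M f) (f (suc M))))

sumTo-indicator-≤1 : ∀ c M → sumTo M (λ k → indicator (c ≡ᵇ k)) ≤ 1
sumTo-indicator-≤1 c zero    = z≤n
sumTo-indicator-≤1 c (suc M) with c ≡ᵇ suc M in c≡ᵇ1+M
... | false = ≤-trans (≤-reflexive (+-identityʳ _)) (sumTo-indicator-≤1 c M)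
... | true with ≡ᵇ≡true⇒≡ {c} {suc M} c≡ᵇ1+M
...   | refl = ≤-reflexive (cong (_+ 1) (below M ≤-refl))
  where
  below : ∀ K → K ≤ M → sumTo K (λ k → indicator (suc M ≡ᵇ k)) ≡ 0
  below zero    _   = refl
  below (suc K) K<1+M rewrite ≢⇒≡ᵇ≡false {suc M} {suc K} (λ eq → <-irrefl (sym eq) (s≤s K<1+M)) =
    trans (+-identityʳ _) (below K (<⇒≤ K<1+M))

sumTo-count-≤ : ∀ M (p : A → Bool) (h : A → ℕ) xs → sumTo M (λ k → count (λ x → p x ∧ (h x ≡ᵇ k)) xs) ≤ count p xs
sumTo-count-≤ M p h []       = ≤-reflexive (sumTo-zero M)
sumTo-count-≤ M p h (x ∷ xs) = begin
  sumTo M (λ k → indicator (p x ∧ (h x ≡ᵇ k)) + count (λ x → p x ∧ (h x ≡ᵇ k)) xs)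
    ≡⟨ sumTo-+ M _ _ ⟩
  sumTo M (λ k → indicator (p x ∧ (h x ≡ᵇ k))) + sumTo M (λ k → count (λ x → p x ∧ (h x ≡ᵇ k)) xs)
    ≤⟨ +-mono-≤ (at-most-once (p x)) (sumTo-count-≤ M p h xs) ⟩
  indicator (p x) + count p xs ∎
  where
  open ≤-Reasoning
  at-most-once : ∀ b → sumTo M (λ k → indicator (b ∧ (h x ≡ᵇ k))) ≤ indicator b
  at-most-once true  = sumTo-indicator-≤1 (h x) M
  at-most-once false = ≤-reflexive (sumTo-zero M)

-- Duplicate-free and sorted lists

private
  ⊆-delete : ∀ {x} {xs : List A} as {bs} → xs ⊆ as ++ x ∷ bs → x ∉ xs → xs ⊆ as ++ bs
  ⊆-delete {x = x} as {bs} xs⊆ x∉xs y∈xs = delete as (xs⊆ y∈xs) (λ y≡x → x∉xs (subst (_∈ _) y≡x y∈xs))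
    where
    delete : ∀ {y} cs → y ∈ cs ++ x ∷ bs → y ≢ x → y ∈ cs ++ bs
    delete []       (here refl) y≢x = ⊥-elim (y≢x refl)
    delete []       (there y∈)  y≢x = y∈
    delete (c ∷ cs) (here refl) y≢x = here refl
    delete (c ∷ cs) (there y∈)  y≢x = there (delete cs y∈ y≢x)

  length-insert : ∀ (as : List A) {x bs} → length (as ++ x ∷ bs) ≡ suc (length (as ++ bs))
  length-insert []       = refl
  length-insert (_ ∷ as) = cong suc (length-insert as)

Unique-⊆⇒length-≤ : {xs ys : List A} → Unique xs → xs ⊆ ys → length xs ≤ length ys
Unique-⊆⇒length-≤ {xs = []}     _          _     = z≤n
Unique-⊆⇒length-≤ {xs = x ∷ xs} (x∉ ∷ uxs) xs⊆ys with ∈-∃++ (xs⊆ys (here refl))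
... | as , bs , refl = subst (suc (length xs) ≤_) (sym (length-insert as))
  (s≤s (Unique-⊆⇒length-≤ uxs (⊆-delete as (xs⊆ys ∘ there) (λ x∈xs → All.lookup x∉ x∈xs refl))))

Unique-⊆-∉⇒length-< : ∀ {y} {xs ys : List A} → Unique xs → xs ⊆ ys → y ∈ ys → y ∉ xs → length xs < length ys
Unique-⊆-∉⇒length-< {xs = xs} uxs xs⊆ys y∈ys y∉xs with ∈-∃++ y∈ys
... | as , bs , refl =
  subst (length xs <_) (sym (length-insert as)) (s≤s (Unique-⊆⇒length-≤ uxs (⊆-delete as xs⊆ys y∉xs)))

Unique-map⁺-on : (f : A → B) {xs : List A} → Unique xs →
  (∀ {x y} → x ∈ xs → y ∈ xs → f x ≡ f y → x ≡ y) → Unique (map f xs)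
Unique-map⁺-on f {[]}     []         injective = []
Unique-map⁺-on f {x ∷ xs} (x∉ ∷ uxs) injective =
  All.map⁺ (All.tabulate (λ y∈ fx≡fy → All.lookup x∉ y∈ (injective (here refl) (there y∈) fx≡fy)))
  ∷ Unique-map⁺-on f uxs (λ x∈ y∈ → injective (there x∈) (there y∈))

Unique-++⁻ʳ : ∀ (xs : List A) {ys} → Unique (xs ++ ys) → Unique ys
Unique-++⁻ʳ []       u       = u
Unique-++⁻ʳ (x ∷ xs) (_ ∷ u) = Unique-++⁻ʳ xs u

Unique-++⇒disjoint : ∀ (xs : List A) {ys x} → Unique (xs ++ ys) → x ∈ xs → x ∉ ys
Unique-++⇒disjoint (x ∷ xs) (x∉ ∷ _) (here refl) x∈ys = All.lookup x∉ (∈-++⁺ʳ xs x∈ys) refl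
Unique-++⇒disjoint (_ ∷ xs) (_ ∷ u)  (there x∈xs) = Unique-++⇒disjoint xs u x∈xs

Unique-resp-↭ : {xs ys : List ℕ} → xs ↭ ys → Unique xs → Unique ys
Unique-resp-↭ σ = ↭ₛ.Unique-resp-↭ (setoid ℕ) (↭⇒↭ₛ σ)

count-≤-by-injection : (p : A → Bool) (q : B → Bool) (f : A → B) {xs : List A} {ys : List B} → Unique xs →
  (∀ {x} → x ∈ xs → T (p x) → f x ∈ ys × T (q (f x))) →
  (∀ {x y} → x ∈ xs → y ∈ xs → T (p x) → T (p y) → f x ≡ f y → x ≡ y) →
  count p xs ≤ count q ys
count-≤-by-injection p q f {xs} {ys} uxs maps-to injective = begin
  count p xs                        ≡⟨ sym (length-filter≡count (T? ∘ p) xs) ⟩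
  length (filterᵇ p xs)             ≡⟨ sym (length-map f (filterᵇ p xs)) ⟩
  length (map f (filterᵇ p xs))     ≤⟨ Unique-⊆⇒length-≤ unique-image image⊆ ⟩
  length (filterᵇ q ys)             ≡⟨ length-filter≡count (T? ∘ q) ys ⟩
  count q ys                        ∎
  where
  open ≤-Reasoning
  unique-image : Unique (map f (filterᵇ p xs))
  unique-image = Unique-map⁺-on f (Unique.filter⁺ (T? ∘ p) uxs) λ x∈ y∈ →
    let x∈xs , px = ∈-filter⁻ (T? ∘ p) {xs = xs} x∈
        y∈xs , py = ∈-filter⁻ (T? ∘ p) {xs = xs} y∈
    in injective x∈xs y∈xs px py
  image⊆ : map f (filterᵇ p xs) ⊆ filterᵇ q ys
  image⊆ v∈ with ∈-map⁻ f v∈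
  ... | x , x∈ , refl with ∈-filter⁻ (T? ∘ p) {xs = xs} x∈
  ... | x∈xs , px = ∈-filter⁺ (T? ∘ q) (proj₁ (maps-to x∈xs px)) (proj₂ (maps-to x∈xs px))

filterᵇ-cong : ∀ {p q : A → Bool} → (∀ x → p x ≡ q x) → ∀ xs → filterᵇ p xs ≡ filterᵇ q xs
filterᵇ-cong {p = p} {q} p≗q = filter-≐ (T? ∘ p) (T? ∘ q) ((λ {x} → subst T (p≗q x)) , (λ {x} → subst T (sym (p≗q x))))

sorted-head : ∀ {x xs} → Linked _<_ (x ∷ xs) → All (x <_) xs
sorted-head sorted = AllPairs.head (Linkedₚ.Linked⇒AllPairs <-trans sorted)

sorted-⊆-⊇⇒≡ : ∀ {xs ys} → Linked _<_ xs → Linked _<_ ys → xs ⊆ ys → ys ⊆ xs → xs ≡ ys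
sorted-⊆-⊇⇒≡ {[]}     {[]}     _  _  _     _     = refl
sorted-⊆-⊇⇒≡ {[]}     {y ∷ ys} _  _  _     ys⊆xs with ys⊆xs (here refl)
... | ()
sorted-⊆-⊇⇒≡ {x ∷ xs} {[]}     _  _  xs⊆ys _     with xs⊆ys (here refl)
... | ()
sorted-⊆-⊇⇒≡ {x ∷ xs} {y ∷ ys} sx sy xs⊆ys ys⊆xs
  with ≤-antisym (head-≤ sy (xs⊆ys (here refl))) (head-≤ sx (ys⊆xs (here refl)))
  where
  head-≤ : ∀ {z zs v} → Linked _<_ (z ∷ zs) → v ∈ z ∷ zs → z ≤ v
  head-≤ _      (here refl) = ≤-refl
  head-≤ sorted (there v∈)  = <⇒≤ (All.lookup (sorted-head sorted) v∈)
... | refl = cong (y ∷_) (sorted-⊆-⊇⇒≡ (Linked.tail sx) (Linked.tail sy)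
  (λ v∈ → drop-head sx v∈ (xs⊆ys (there v∈))) (λ v∈ → drop-head sy v∈ (ys⊆xs (there v∈))))
  where
  drop-head : ∀ {zs us v} → Linked _<_ (y ∷ zs) → v ∈ zs → v ∈ y ∷ us → v ∈ us
  drop-head sorted v∈zs (here refl) = ⊥-elim (<-irrefl refl (All.lookup (sorted-head sorted) v∈zs))
  drop-head sorted v∈zs (there v∈us) = v∈us

any-≡ᵇ⇒∈ : ∀ {a} w → T (any (_≡ᵇ a) w) → a ∈ w
any-≡ᵇ⇒∈ {a} (x ∷ w) t with x ≡ᵇ a in x≡ᵇa
... | true  = here (sym (≡ᵇ≡true⇒≡ x≡ᵇa))
... | false = there (any-≡ᵇ⇒∈ w t)

∈⇒any-≡ᵇ : ∀ {a} w → a ∈ w → T (any (_≡ᵇ a) w)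
∈⇒any-≡ᵇ {a} (.a ∷ w) (here refl) rewrite ≡ᵇ-refl a = tt
∈⇒any-≡ᵇ {a} (x ∷ w) (there a∈) with x ≡ᵇ a
... | true  = tt
... | false = ∈⇒any-≡ᵇ w a∈

-- Words

range : ℕ → ℕ → List ℕ
range o zero    = []
range o (suc m) = o ∷ range (suc o) m

length-range : ∀ o m → length (range o m) ≡ m
length-range o zero    = refl
length-range o (suc m) = cong suc (length-range (suc o) m)

∈-range⁻ : ∀ {j} o m → j ∈ range o m → o ≤ j × j < o + m
∈-range⁻ o (suc m) (here refl) = ≤-refl , m<m+n o z<s
∈-range⁻ {j} o (suc m) (there j∈) with ∈-range⁻ (suc o) m j∈
... | o<j , j<o+1+m = <⇒≤ o<j , subst (j <_) (sym (+-suc o m)) j<o+1+m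

∈-range⁺ : ∀ {j} o m → o ≤ j → j < o + m → j ∈ range o m
∈-range⁺ {j} o zero    o≤j j<o+0 = ⊥-elim (<⇒≱ j<o+0 (subst (_≤ j) (sym (+-identityʳ o)) o≤j))
∈-range⁺ {j} o (suc m) o≤j j<o+m with m≤n⇒m<n∨m≡n o≤j
... | inj₂ refl = here refl
... | inj₁ o<j  = there (∈-range⁺ (suc o) m o<j (subst (j <_) (+-suc o m) j<o+m))

range-unique : ∀ o m → Unique (range o m)
range-unique o zero    = []
range-unique o (suc m) =
  All.tabulate (λ j∈ o≡j → <-irrefl o≡j (proj₁ (∈-range⁻ (suc o) m j∈))) ∷ range-unique (suc o) m

range-sorted : ∀ o m → Linked _<_ (range o m)
range-sorted o zero          = []
range-sorted o (suc zero)    = [-]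
range-sorted o (suc (suc m)) = n<1+n o ∷ range-sorted (suc o) (suc m)

map-suc-upTo : ∀ n → map suc (upTo n) ≡ range 1 n
map-suc-upTo n = go id 1 n (λ _ → refl)
  where
  go : ∀ (f : ℕ → ℕ) o m → (∀ i → suc (f i) ≡ o + i) → map suc (applyUpTo f m) ≡ range o m
  go f o zero    e = refl
  go f o (suc m) e =
    cong₂ _∷_ (trans (e 0) (+-identityʳ o)) (go (f ∘ suc) (suc o) m (λ i → trans (e (suc i)) (+-suc o i)))

∈-words⁻ : ∀ {w : List ℕ} m xs → w ∈ words m xs → length w ≡ m × All (_∈ xs) w
∈-words⁻ zero    xs (here refl) = refl , []
∈-words⁻ (suc m) xs w∈ with find (∈-concatMap⁻ (λ x → map (x ∷_) (words m xs)) {xs = xs} w∈)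
... | x , x∈ , w∈x∷ with ∈-map⁻ (x ∷_) w∈x∷
... | w′ , w′∈ , refl with ∈-words⁻ m xs w′∈
... | len , all = cong suc len , (x∈ ∷ all)

∈-words⁺ : ∀ {w : List ℕ} m xs → length w ≡ m → All (_∈ xs) w → w ∈ words m xs
∈-words⁺ {[]}    zero    xs len all        = here refl
∈-words⁺ {x ∷ w} (suc m) xs len (x∈ ∷ all) =
  ∈-concatMap⁺ (λ y → map (y ∷_) (words m xs)) {xs = xs}
    (lose x∈ (∈-map⁺ (x ∷_) (∈-words⁺ m xs (suc-injective len) all)))

words-unique : ∀ m xs → Unique xs → Unique (words m xs)
words-unique zero    xs u = [] ∷ []
words-unique (suc m) xs u = unique-concatMap xs u
  where
  unique-concatMap : ∀ ys → Unique ys → Unique (concatMap (λ y → map (y ∷_) (words m xs)) ys)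
  unique-concatMap []       []         = []
  unique-concatMap (y ∷ ys) (y∉ ∷ uys) =
    Unique.++⁺ (Unique.map⁺ (proj₂ ∘ ∷-injective) (words-unique m xs u)) (unique-concatMap ys uys) disjoint
    where
    disjoint : ∀ {v} → v ∈ map (y ∷_) (words m xs) × v ∈ concatMap (λ y → map (y ∷_) (words m xs)) ys → ⊥
    disjoint (v∈y , v∈ys) with find (∈-concatMap⁻ (λ y → map (y ∷_) (words m xs)) {xs = ys} v∈ys)
    ... | z , z∈ , v∈z with ∈-map⁻ (y ∷_) v∈y | ∈-map⁻ (z ∷_) v∈z
    ... | _ , _ , refl | _ , _ , eq = All.lookup y∉ z∈ (proj₁ (∷-injective eq))

count-words : ∀ (p : List ℕ → Bool) m xs →
  count p (words (suc m) xs) ≡ sumMap (λ x → count (λ w → p (x ∷ w)) (words m xs)) xs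
count-words p m xs = trans (count-concatMap p (λ x → map (x ∷_) (words m xs)) xs)
  (sumMap-cong _ _ xs (λ x _ → count-map p (x ∷_) (words m xs)))

length-words : ∀ m (xs : List ℕ) → length (words m xs) ≡ length xs ^ m
length-words zero    xs = refl
length-words (suc m) xs = begin
  length (words (suc m) xs)                          ≡⟨ length≡count-true (words (suc m) xs) ⟩
  count (λ _ → true) (words (suc m) xs)              ≡⟨ count-words (λ _ → true) m xs ⟩
  sumMap (λ _ → count (λ _ → true) (words m xs)) xs  ≡⟨ sumMap-const _ xs ⟩
  length xs * count (λ _ → true) (words m xs)        ≡⟨ cong (length xs *_) (sym (length≡count-true (words m xs))) ⟩
  length xs * length (words m xs)                    ≡⟨ cong (length xs *_) (length-words m xs) ⟩
  length xs ^ suc m                                  ∎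
  where open ≡-Reasoning

-- From words to permutations

letters : ℕ → List ℕ
letters d = range 1 (suc d)

wordsOver : ℕ → ℕ → List (List ℕ)
wordsOver d n = words n (letters d)

positions : ℕ → List ℕ → ℕ → List ℕ
positions a []      o = []
positions a (x ∷ w) o = if x ≡ᵇ a then o ∷ positions a w (suc o) else positions a w (suc o)

blocks : ℕ → List ℕ → List (List ℕ)
blocks d w = map (λ a → positions a w 1) (letters d)

toPerm : ℕ → List ℕ → List ℕ
toPerm d w = concat (blocks d w)

positions-≥ : ∀ a w o → All (o ≤_) (positions a w o)
positions-≥ a []      o = []
positions-≥ a (x ∷ w) o with x ≡ᵇ a
... | true  = ≤-refl ∷ All.map <⇒≤ (positions-≥ a w (suc o))
... | false = All.map <⇒≤ (positions-≥ a w (suc o))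

positions-sorted : ∀ a w o → Linked _<_ (positions a w o)
positions-sorted a []      o = []
positions-sorted a (x ∷ w) o with x ≡ᵇ a
... | false = positions-sorted a w (suc o)
... | true with positions a w (suc o) | positions-≥ a w (suc o) | positions-sorted a w (suc o)
...   | []     | _       | _      = [-]
...   | _ ∷ _  | o<p ∷ _ | sorted = o<p ∷ sorted

positions-++-↭ : ∀ w o as → All (_∈ as) w → Unique as →
  concatMap (λ a → positions a w o) as ↭ range o (length w)
positions-++-↭ []      o as _ _ = ↭-reflexive (none as)
  where
  none : ∀ bs → concatMap (λ a → positions a [] o) bs ≡ []
  none []       = refl
  none (_ ∷ bs) = none bs
positions-++-↭ (x ∷ w) o as (x∈ ∷ w⊆as) uas =
  ↭-trans (peel as x∈ uas) (prep o (positions-++-↭ w (suc o) as w⊆as uas))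
  where
  skip : ∀ bs → x ∉ bs → concatMap (λ a → positions a (x ∷ w) o) bs ≡ concatMap (λ a → positions a w (suc o)) bs
  skip []       _  = refl
  skip (b ∷ bs) x∉ rewrite ≢⇒≡ᵇ≡false {x} {b} (x∉ ∘ here) = cong (positions b w (suc o) ++_) (skip bs (x∉ ∘ there))
  peel : ∀ bs → x ∈ bs → Unique bs →
    concatMap (λ a → positions a (x ∷ w) o) bs ↭ o ∷ concatMap (λ a → positions a w (suc o)) bs
  peel (b ∷ bs) x∈ (b∉ ∷ ubs) with x ≡ᵇ b in eq | x∈
  ... | true  | _ with ≡ᵇ≡true⇒≡ {x} {b} eq
  ...   | refl = prep o (++⁺ˡ (positions x w (suc o)) (↭-reflexive (skip bs (λ x∈bs → All.lookup b∉ x∈bs refl))))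
  peel (b ∷ bs) x∈ (b∉ ∷ ubs) | false | here x≡b   = ⊥-elim (≡ᵇ≡false⇒≢ eq x≡b)
  peel (b ∷ bs) x∈ (b∉ ∷ ubs) | false | there x∈bs =
    ↭-trans (++⁺ˡ (positions b w (suc o)) (peel bs x∈bs ubs)) (shift o (positions b w (suc o)) _)

toPerm-↭ : ∀ d n w → w ∈ wordsOver d n → toPerm d w ↭ range 1 n
toPerm-↭ d n w w∈ with ∈-words⁻ n (letters d) w∈
... | refl , w⊆letters = positions-++-↭ w 1 (letters d) w⊆letters (range-unique 1 (suc d))

toPerm∈perms : ∀ d n w → w ∈ wordsOver d n → toPerm d w ∈ perms n
toPerm∈perms d n w w∈ =
  ∈-filter⁺ unique? (∈-words⁺ n (map suc (upTo n)) len values⊆) (Unique-resp-↭ (↭-sym σ) (range-unique 1 n))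
  where
  σ = toPerm-↭ d n w w∈
  len : length (toPerm d w) ≡ n
  len = trans (↭-length σ) (length-range 1 n)
  values⊆ : All (_∈ map suc (upTo n)) (toPerm d w)
  values⊆ = All.tabulate (λ y∈ → subst (_ ∈_) (sym (map-suc-upTo n)) (∈-resp-↭ σ y∈))

-- 0 when w contains no letter 1.
firstOne : List ℕ → ℕ
firstOne w = first (positions 1 w 1)

lastOf : ℕ → List ℕ → ℕ
lastOf x []       = x
lastOf x (y ∷ ys) = lastOf y ys

lastOf-∈ : ∀ x xs → lastOf x xs ∈ x ∷ xs
lastOf-∈ x []       = here refl
lastOf-∈ x (y ∷ ys) = there (lastOf-∈ y ys)

Descends : List ℕ → List ℕ → Set
Descends []      _       = ⊥
Descends (x ∷ b) []      = ⊥
Descends (x ∷ b) (y ∷ c) = y < lastOf x b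

precedes : ℕ → ℕ → List ℕ → Bool
precedes b a []      = false
precedes b a (x ∷ w) = if x ≡ᵇ b then any (_≡ᵇ a) w else precedes b a w

good : ℕ → List ℕ → Bool
good d w = all (λ a → precedes (suc a) a w) (range 1 d)

positions-nonempty : ∀ a w o → T (any (_≡ᵇ a) w) → Σ ℕ λ p → Σ (List ℕ) λ ps → positions a w o ≡ p ∷ ps
positions-nonempty a (x ∷ w) o a∈w with x ≡ᵇ a
... | true  = o , positions a w (suc o) , refl
... | false = positions-nonempty a w (suc o) a∈w

precedes⇒Descends : ∀ b a w o → a ≢ b → T (precedes b a w) → Descends (positions a w o) (positions b w o)
precedes⇒Descends b a (x ∷ w) o a≢b b≺a with x ≡ᵇ b in x≡ᵇb
... | true rewrite ≢⇒≡ᵇ≡false {x} {a} (λ x≡a → a≢b (trans (sym x≡a) (≡ᵇ≡true⇒≡ x≡ᵇb)))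
  with positions-nonempty a w (suc o) b≺a
...   | p , ps , eq rewrite eq = All.lookup (subst (All (suc o ≤_)) eq (positions-≥ a w (suc o))) (lastOf-∈ p ps)
precedes⇒Descends b a (x ∷ w) o a≢b b≺a | false with x ≡ᵇ a | precedes⇒Descends b a w (suc o) a≢b b≺a
... | true  | descends = extend (positions a w (suc o)) (positions b w (suc o)) descends
  where
  extend : ∀ as bs → Descends as bs → Descends (o ∷ as) bs
  extend (_ ∷ _) (_ ∷ _) descends = descends
... | false | descends = descends

good⇒blocks-Descend : ∀ d w → T (good d w) → Linked Descends (blocks d w)
good⇒blocks-Descend d w g = go 1 d (λ a a∈ → precedes⇒Descends (suc a) a w 1 (a≢1+a a) (All.lookup precedes-all a∈))
  where
  a≢1+a : ∀ a → a ≢ suc a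
  a≢1+a a a≡1+a = <-irrefl a≡1+a (n<1+n a)
  precedes-all : All (λ a → T (precedes (suc a) a w)) (range 1 d)
  precedes-all = All.all⁺ _ (range 1 d) g
  go : ∀ o m → (∀ a → a ∈ range o m → Descends (positions a w 1) (positions (suc a) w 1)) →
    Linked Descends (map (λ a → positions a w 1) (range o (suc m)))
  go o zero    h = [-]
  go o (suc m) h = h o (here refl) ∷ go (suc o) m (λ a → h a ∘ there)

-- Ascending runs

consRun : ℕ → ℕ → List (List ℕ) → List (List ℕ)
consRun x y []       = []
consRun x y (R ∷ Rs) = if y <ᵇ x then (x ∷ []) ∷ R ∷ Rs else (x ∷ R) ∷ Rs

runsFrom : ℕ → List ℕ → List (List ℕ)
runsFrom x []      = (x ∷ []) ∷ []
runsFrom x (y ∷ r) = consRun x y (runsFrom y r)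

runs : List ℕ → List (List ℕ)
runs []      = []
runs (x ∷ r) = runsFrom x r

runsFrom-shape : ∀ x r → Σ (List ℕ) λ R → Σ (List (List ℕ)) λ Rs → runsFrom x r ≡ (x ∷ R) ∷ Rs
runsFrom-shape x []      = [] , [] , refl
runsFrom-shape x (y ∷ r) with runsFrom y r | runsFrom-shape y r
... | _ | R , Rs , refl with y <ᵇ x
...   | true  = [] , (y ∷ R) ∷ Rs , refl
...   | false = y ∷ R , Rs , refl

length-runsFrom : ∀ x r → length (runsFrom x r) ≡ suc (des (x ∷ r))
length-runsFrom x []      = refl
length-runsFrom x (y ∷ r) with runsFrom y r | runsFrom-shape y r | length-runsFrom y r
... | _ | R , Rs , refl | ih with y <ᵇ x
...   | true  = cong suc ih
...   | false = ih

concat-runsFrom : ∀ x r → concat (runsFrom x r) ≡ x ∷ r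
concat-runsFrom x []      = refl
concat-runsFrom x (y ∷ r) with runsFrom y r | runsFrom-shape y r | concat-runsFrom y r
... | _ | R , Rs , refl | ih with y <ᵇ x
...   | true  = cong (x ∷_) ih
...   | false = cong (x ∷_) ih

runsFrom-sorted : ∀ x r → Unique (x ∷ r) → All (Linked _<_) (runsFrom x r)
runsFrom-sorted x []      _            = [-] ∷ []
runsFrom-sorted x (y ∷ r) (x∉ ∷ uy∷r) with runsFrom y r | runsFrom-shape y r | runsFrom-sorted y r uy∷r
... | _ | R , Rs , refl | sorted ∷ sorteds with y <ᵇ x in y<ᵇx
...   | true  = [-] ∷ sorted ∷ sorteds
...   | false = (x<y ∷ sorted) ∷ sorteds
  where
  x<y : x < y
  x<y with <-cmp x y
  ... | tri< x<y _ _   = x<y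
  ... | tri≈ _ x≡y _   = ⊥-elim (All.lookup x∉ (here refl) x≡y)
  ... | tri> _ _ y<x   = ⊥-elim (subst T y<ᵇx (<⇒<ᵇ y<x))

StartsBelow : ℕ → List ℕ → Set
StartsBelow l []      = ⊤
StartsBelow l (y ∷ r) = y < l

runsFrom-++ : ∀ x b rest → Linked _<_ (x ∷ b) → StartsBelow (lastOf x b) rest →
  runsFrom x (b ++ rest) ≡ (x ∷ b) ∷ runs rest
runsFrom-++ x []      []      _ _ = refl
runsFrom-++ x []      (y ∷ r) _ y<x with runsFrom y r | runsFrom-shape y r
... | _ | R , Rs , refl rewrite <⇒<ᵇ≡true y<x = refl
runsFrom-++ x (z ∷ b) rest (x<z ∷ sorted) below
  rewrite runsFrom-++ z b rest sorted below | ≤⇒<ᵇ≡false (<⇒≤ x<z) = refl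

runs-concat : ∀ x b bs → All (Linked _<_) ((x ∷ b) ∷ bs) → Linked Descends ((x ∷ b) ∷ bs) →
  runs (concat ((x ∷ b) ∷ bs)) ≡ (x ∷ b) ∷ bs
runs-concat x b []               (sorted ∷ _)       _                   = runsFrom-++ x b [] sorted tt
runs-concat x b ((y ∷ c) ∷ bs) (sorted ∷ sorteds) (y<last ∷ descends) =
  trans (runsFrom-++ x b (concat ((y ∷ c) ∷ bs)) sorted y<last)
        (cong ((x ∷ b) ∷_) (runs-concat y c bs sorteds descends))

module _ (e : ℕ) (w : List ℕ) (w-good : T (good (suc e) w)) where

  private
    firstBlock-nonempty : Σ ℕ λ p → Σ (List ℕ) λ ps → positions 1 w 1 ≡ p ∷ ps
    firstBlock-nonempty with positions 1 w 1 | good⇒blocks-Descend (suc e) w w-good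
    ... | p ∷ ps | _      = p , ps , refl
    ... | []     | () ∷ _

    laterBlocks : List (List ℕ)
    laterBlocks = map (λ a → positions a w 1) (range 2 (suc e))

  runs-toPerm : runs (toPerm (suc e) w) ≡ blocks (suc e) w
  runs-toPerm with firstBlock-nonempty
  ... | p , ps , eq rewrite eq =
    runs-concat p ps laterBlocks (subst (All (Linked _<_)) eq₁ blocks-sorted)
                                 (subst (Linked Descends) eq₁ (good⇒blocks-Descend (suc e) w w-good))
    where
    eq₁ : blocks (suc e) w ≡ (p ∷ ps) ∷ laterBlocks
    eq₁ = cong (_∷ laterBlocks) eq
    blocks-sorted : All (Linked _<_) (blocks (suc e) w)
    blocks-sorted = All.map⁺ (All.universal (λ a → positions-sorted a w 1) _)

  des-toPerm : des (toPerm (suc e) w) ≡ suc e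
  des-toPerm with firstBlock-nonempty
  ... | p , ps , eq = suc-injective (begin
    suc (des (toPerm (suc e) w))          ≡⟨ cong (suc ∘ des) toPerm≡ ⟩
    suc (des (p ∷ rest))                  ≡⟨ length-runsFrom p rest ⟨
    length (runs (p ∷ rest))              ≡⟨ cong (length ∘ runs) toPerm≡ ⟨
    length (runs (toPerm (suc e) w))      ≡⟨ cong length runs-toPerm ⟩
    length (blocks (suc e) w)             ≡⟨ length-map _ (letters (suc e)) ⟩
    length (letters (suc e))              ≡⟨ length-range 1 (suc (suc e)) ⟩
    suc (suc e)                           ∎)
    where
    open ≡-Reasoning
    rest = ps ++ concat laterBlocks
    toPerm≡ : toPerm (suc e) w ≡ p ∷ rest
    toPerm≡ = cong (_++ concat laterBlocks) eq

  first-toPerm : first (toPerm (suc e) w) ≡ firstOne w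
  first-toPerm with firstBlock-nonempty
  ... | p , ps , eq rewrite eq = refl

positions-injective : ∀ {w w′} o as → All (_∈ as) w → length w ≡ length w′ →
  (∀ {a} → a ∈ as → positions a w o ≡ positions a w′ o) → w ≡ w′
positions-injective {[]}    {[]}      o as _           _   _    = refl
positions-injective {x ∷ w} {x′ ∷ w′} o as (x∈ ∷ w⊆as) len same with heads-agree (same x∈)
  where
  heads-agree : positions x (x ∷ w) o ≡ positions x (x′ ∷ w′) o → x′ ≡ x
  heads-agree eq with x′ ≡ᵇ x in x′≡ᵇx
  ... | true  = ≡ᵇ≡true⇒≡ x′≡ᵇx
  ... | false rewrite ≡ᵇ-refl x =
    ⊥-elim (<-irrefl refl (All.lookup (subst (All (suc o ≤_)) (sym eq) (positions-≥ x w′ (suc o))) (here refl)))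
... | refl = cong (x ∷_) (positions-injective (suc o) as w⊆as (suc-injective len) (tails-agree ∘ same))
  where
  tails-agree : ∀ {a} → positions a (x ∷ w) o ≡ positions a (x ∷ w′) o → positions a w (suc o) ≡ positions a w′ (suc o)
  tails-agree {a} eq with x ≡ᵇ a
  ... | true  = proj₂ (∷-injective eq)
  ... | false = eq

blocks-injective : ∀ d n {w w′} → w ∈ wordsOver d n → w′ ∈ wordsOver d n → blocks d w ≡ blocks d w′ → w ≡ w′
blocks-injective d n {w} {w′} w∈ w′∈ eq with ∈-words⁻ n (letters d) w∈ | ∈-words⁻ n (letters d) w′∈
... | len , w⊆letters | len′ , _ =
  positions-injective 1 (letters d) w⊆letters (trans len (sym len′)) (pointwise (letters d) eq)
  where
  pointwise : ∀ as → map (λ a → positions a w 1) as ≡ map (λ a → positions a w′ 1) as →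
    ∀ {a} → a ∈ as → positions a w 1 ≡ positions a w′ 1
  pointwise (_ ∷ as) eq (here refl) = proj₁ (∷-injective eq)
  pointwise (_ ∷ as) eq (there a∈)  = pointwise as (proj₂ (∷-injective eq)) a∈

toPerm-injective : ∀ e n {w w′} → w ∈ wordsOver (suc e) n → w′ ∈ wordsOver (suc e) n →
  T (good (suc e) w) → T (good (suc e) w′) → toPerm (suc e) w ≡ toPerm (suc e) w′ → w ≡ w′
toPerm-injective e n {w} {w′} w∈ w′∈ w-good w′-good eq =
  blocks-injective (suc e) n w∈ w′∈
    (trans (sym (runs-toPerm e w w-good)) (trans (cong runs eq) (runs-toPerm e w′ w′-good)))

-- From permutations to words

-- `runIndex c rs j` is `c + i` when `j` lies in the run `rs[i]`, and `0` when it lies in no run.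
runIndex : ℕ → List (List ℕ) → ℕ → ℕ
runIndex c []       j = 0
runIndex c (R ∷ rs) j = if any (_≡ᵇ j) R then c else runIndex (suc c) rs j

toWord : ℕ → List ℕ → List ℕ
toWord n π = map (runIndex 1 (runs π)) (range 1 n)

runIndex-∉ : ∀ c rs j → j ∉ concat rs → runIndex c rs j ≡ 0
runIndex-∉ c []       j _  = refl
runIndex-∉ c (R ∷ rs) j j∉ with any (_≡ᵇ j) R in j∈?R
... | true  = ⊥-elim (j∉ (∈-++⁺ˡ (any-≡ᵇ⇒∈ R (Equivalence.from T-≡ j∈?R))))
... | false = runIndex-∉ (suc c) rs j (j∉ ∘ ∈-++⁺ʳ R)

runIndex-≡0⊎≥ : ∀ c rs j → runIndex c rs j ≡ 0 ⊎ c ≤ runIndex c rs j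
runIndex-≡0⊎≥ c []       j = inj₁ refl
runIndex-≡0⊎≥ c (R ∷ rs) j with any (_≡ᵇ j) R
... | true  = inj₂ ≤-refl
... | false with runIndex-≡0⊎≥ (suc c) rs j
...   | inj₁ ≡0 = inj₁ ≡0
...   | inj₂ ≥c = inj₂ (<⇒≤ ≥c)

runIndex-∈ : ∀ c rs j → j ∈ concat rs → c ≤ runIndex c rs j × runIndex c rs j < c + length rs
runIndex-∈ c (R ∷ rs) j j∈ with any (_≡ᵇ j) R in j∈?R
... | true  = ≤-refl , m<m+n c z<s
... | false with ∈-++⁻ R j∈
...   | inj₁ j∈R  = ⊥-elim (subst T j∈?R (∈⇒any-≡ᵇ R j∈R))
...   | inj₂ j∈rs with runIndex-∈ (suc c) rs j j∈rs
...     | c<i , i<1+c+l = <⇒≤ c<i , subst (runIndex (suc c) rs j <_) (sym (+-suc c (length rs))) i<1+c+l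

filter-runIndex : ∀ c rs S → 1 ≤ c → All (Linked _<_) rs → Unique (concat rs) → concat rs ⊆ S → Linked _<_ S →
  map (λ a → filterᵇ (λ j → runIndex c rs j ≡ᵇ a) S) (range c (length rs)) ≡ rs
filter-runIndex c []       S _   _                 _   _     _  = refl
filter-runIndex c (R ∷ rs) S 1≤c (R-sorted ∷ sorted) urs rs⊆S sS = cong₂ _∷_ first-run later-runs
  where
  index = runIndex c (R ∷ rs)
  first-run : filterᵇ (λ j → index j ≡ᵇ c) S ≡ R
  first-run = sorted-⊆-⊇⇒≡ (Linkedₚ.filter⁺ (T? ∘ (λ j → index j ≡ᵇ c)) <-trans sS) R-sorted filtered⊆R R⊆filtered
    where
    filtered⊆R : filterᵇ (λ j → index j ≡ᵇ c) S ⊆ R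
    filtered⊆R {z} z∈ with proj₂ (∈-filter⁻ (T? ∘ (λ j → index j ≡ᵇ c)) {xs = S} z∈)
    ... | index≡c with any (_≡ᵇ z) R in z∈?R
    ...   | true  = any-≡ᵇ⇒∈ R (Equivalence.from T-≡ z∈?R)
    ...   | false with runIndex-≡0⊎≥ (suc c) rs z
    ...     | inj₁ ≡0  = ⊥-elim (<-irrefl (trans (sym ≡0) (≡ᵇ⇒≡ _ c index≡c)) 1≤c)
    ...     | inj₂ ≥1+c = ⊥-elim (<-irrefl (sym (≡ᵇ⇒≡ _ c index≡c)) ≥1+c)
    R⊆filtered : R ⊆ filterᵇ (λ j → index j ≡ᵇ c) S
    R⊆filtered {z} z∈R = ∈-filter⁺ (T? ∘ (λ j → index j ≡ᵇ c)) (rs⊆S (∈-++⁺ˡ z∈R)) index≡c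
      where
      index≡c : T (index z ≡ᵇ c)
      index≡c rewrite Equivalence.to T-≡ (∈⇒any-≡ᵇ R z∈R) = ≡⇒≡ᵇ c c refl
  later-runs : map (λ a → filterᵇ (λ j → index j ≡ᵇ a) S) (range (suc c) (length rs)) ≡ rs
  later-runs = trans (map-cong-local (All.tabulate λ a∈ → filterᵇ-cong (same-test a∈) S))
                     (filter-runIndex (suc c) rs S (m≤n⇒m≤1+n 1≤c) sorted (Unique-++⁻ʳ R urs) (rs⊆S ∘ ∈-++⁺ʳ R) sS)
    where
    same-test : ∀ {a} → a ∈ range (suc c) (length rs) → ∀ j → (index j ≡ᵇ a) ≡ (runIndex (suc c) rs j ≡ᵇ a)
    same-test {a} a∈ j with any (_≡ᵇ j) R in j∈?R
    ... | false = refl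
    ... | true rewrite runIndex-∉ (suc c) rs j (Unique-++⇒disjoint R urs (any-≡ᵇ⇒∈ R (Equivalence.from T-≡ j∈?R)))
      = trans (≢⇒≡ᵇ≡false (λ c≡a → <-irrefl c≡a c<a)) (sym (≢⇒≡ᵇ≡false (λ 0≡a → <-irrefl 0≡a (<-≤-trans z<s c<a))))
      where c<a = proj₁ (∈-range⁻ (suc c) (length rs) a∈)

positions-map-range : ∀ a (g : ℕ → ℕ) o m → positions a (map g (range o m)) o ≡ filterᵇ (λ j → g j ≡ᵇ a) (range o m)
positions-map-range a g o zero    = refl
positions-map-range a g o (suc m) with g o ≡ᵇ a
... | true  = cong (o ∷_) (positions-map-range a g (suc o) m)
... | false = positions-map-range a g (suc o) m

∈-perms⁻ : ∀ n {π} → π ∈ perms n → length π ≡ n × π ⊆ range 1 n × Unique π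
∈-perms⁻ n π∈ with ∈-filter⁻ unique? {xs = words n (map suc (upTo n))} π∈
... | π∈words , uπ with ∈-words⁻ n (map suc (upTo n)) π∈words
... | len , π⊆ = len , (λ j∈ → subst (_ ∈_) (map-suc-upTo n) (All.lookup π⊆ j∈)) , uπ

∈-permsDes⁻ : ∀ n d {π} → π ∈ permsDes n d → π ∈ perms n × des π ≡ d
∈-permsDes⁻ n d = ∈-filter⁻ (λ π → des π ℕ.≟ d)

perm-⊇-range : ∀ n {π} → π ∈ perms n → range 1 n ⊆ π
perm-⊇-range n π∈ {j} j∈ with ∈-perms⁻ n π∈ | j ∈? _
... | _         , _    , _  | yes j∈π = j∈π
... | refl , π⊆ , uπ | no j∉π  = ⊥-elim (<-irrefl (sym (length-range 1 _)) (Unique-⊆-∉⇒length-< uπ π⊆ j∈ j∉π))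

concat-runs : ∀ π → concat (runs π) ≡ π
concat-runs []      = refl
concat-runs (x ∷ r) = concat-runsFrom x r

length-runs : ∀ {π d} → des π ≡ suc d → length (runs π) ≡ suc (suc d)
length-runs {x ∷ r} des≡ = trans (length-runsFrom x r) (cong suc des≡)

runs-first : ∀ {π d} → des π ≡ suc d → Σ (List ℕ) λ R → Σ (List (List ℕ)) λ Rs → runs π ≡ (first π ∷ R) ∷ Rs
runs-first {x ∷ r} _ = runsFrom-shape x r

runs-sorted : ∀ {π} → Unique π → All (Linked _<_) (runs π)
runs-sorted {[]}    _  = []
runs-sorted {x ∷ r} uπ = runsFrom-sorted x r uπ

module _ (e n : ℕ) {π : List ℕ} (π∈ : π ∈ permsDes n (suc e)) where

  private
    π∈perms = proj₁ (∈-permsDes⁻ n (suc e) π∈)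
    des≡ = proj₂ (∈-permsDes⁻ n (suc e) π∈)
    index = runIndex 1 (runs π)

  blocks-toWord : blocks (suc e) (toWord n π) ≡ runs π
  blocks-toWord = begin
    map (λ a → positions a (map index (range 1 n)) 1) (range 1 (suc (suc e)))
      ≡⟨ map-cong (λ a → positions-map-range a index 1 n) _ ⟩
    map (λ a → filterᵇ (λ j → index j ≡ᵇ a) (range 1 n)) (range 1 (suc (suc e)))
      ≡⟨ cong (map (λ a → filterᵇ (λ j → index j ≡ᵇ a) (range 1 n)) ∘ range 1) (length-runs {π} des≡) ⟨
    map (λ a → filterᵇ (λ j → index j ≡ᵇ a) (range 1 n)) (range 1 (length (runs π)))
      ≡⟨ filter-runIndex 1 (runs π) (range 1 n) ≤-refl (runs-sorted uπ) (subst Unique (sym (concat-runs π)) uπ)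
           (π⊆ ∘ subst (_ ∈_) (concat-runs π)) (range-sorted 1 n) ⟩
    runs π ∎
    where
    open ≡-Reasoning
    π⊆ = proj₁ (proj₂ (∈-perms⁻ n π∈perms))
    uπ = proj₂ (proj₂ (∈-perms⁻ n π∈perms))

  toPerm-toWord : toPerm (suc e) (toWord n π) ≡ π
  toPerm-toWord = trans (cong concat blocks-toWord) (concat-runs π)

  firstOne-toWord : firstOne (toWord n π) ≡ first π
  firstOne-toWord with runs-first {π} des≡
  ... | R , Rs , eq = cong first (proj₁ (∷-injective (trans blocks-toWord eq)))

  toWord∈wordsOver : toWord n π ∈ wordsOver (suc e) n
  toWord∈wordsOver = ∈-words⁺ n (letters (suc e)) (trans (length-map index (range 1 n)) (length-range 1 n))
    (All.map⁺ (All.tabulate index∈letters))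
    where
    index∈letters : ∀ {j} → j ∈ range 1 n → index j ∈ letters (suc e)
    index∈letters j∈ with runIndex-∈ 1 (runs π) _ (subst (_ ∈_) (sym (concat-runs π)) (perm-⊇-range n π∈perms j∈))
    ... | 1≤i , i<1+l = ∈-range⁺ 1 (suc (suc e)) 1≤i (subst (λ l → index _ < 1 + l) (length-runs {π} des≡) i<1+l)

-- Counting words

perms-unique : ∀ n → Unique (perms n)
perms-unique n = Unique.filter⁺ unique? (words-unique n _ (subst Unique (sym (map-suc-upTo n)) (range-unique 1 n)))

permsDes-unique : ∀ n d → Unique (permsDes n d)
permsDes-unique n d = Unique.filter⁺ (λ π → des π ℕ.≟ d) (perms-unique n)

wordsOver-unique : ∀ d n → Unique (wordsOver d n)
wordsOver-unique d n = words-unique n (letters d) (range-unique 1 (suc d))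

length-wordsOver : ∀ d n → length (wordsOver d n) ≡ suc d ^ n
length-wordsOver d n = trans (length-words n (letters d)) (cong (_^ n) (length-range 1 (suc d)))

module _ (e n : ℕ) (Q : ℕ → Bool) where

  count-permsDes-≤-wordsOver : count (Q ∘ first) (permsDes n (suc e)) ≤ count (Q ∘ firstOne) (wordsOver (suc e) n)
  count-permsDes-≤-wordsOver = count-≤-by-injection (Q ∘ first) (Q ∘ firstOne) (toWord n) (permsDes-unique n (suc e))
    (λ π∈ Qπ → toWord∈wordsOver e n π∈ , subst (T ∘ Q) (sym (firstOne-toWord e n π∈)) Qπ)
    (λ π∈ π′∈ _ _ eq → trans (sym (toPerm-toWord e n π∈)) (trans (cong (toPerm (suc e)) eq) (toPerm-toWord e n π′∈)))

  count-good-≤-permsDes :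
    count (λ w → good (suc e) w ∧ Q (firstOne w)) (wordsOver (suc e) n) ≤ count (Q ∘ first) (permsDes n (suc e))
  count-good-≤-permsDes = count-≤-by-injection _ (Q ∘ first) (toPerm (suc e)) (wordsOver-unique (suc e) n)
    (λ {w} w∈ good∧Q → let w-good , Qw = Equivalence.to T-∧ good∧Q in
      ∈-filter⁺ (λ π → des π ℕ.≟ suc e) (toPerm∈perms (suc e) n w w∈) (des-toPerm e w w-good) ,
      subst (T ∘ Q) (sym (first-toPerm e w w-good)) Qw)
    (λ w∈ w′∈ good∧Q good∧Q′ →
      toPerm-injective e n w∈ w′∈ (proj₁ (Equivalence.to T-∧ good∧Q)) (proj₁ (Equivalence.to T-∧ good∧Q′)))

module _ (d : ℕ) .{{_ : NonZero d}} where

  private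
    sumMap-letters-≤ : ∀ (f : ℕ → ℕ) {b U V} → b ∈ letters d → f b ≤ U → (∀ {x} → x ∈ letters d → x ≢ b → f x ≤ V) →
      sumMap f (letters d) ≤ U + d * V
    sumMap-letters-≤ f {U = U} {V} b∈ fb≤U f≤V = +-cancelʳ-≤ V _ _ (begin
      sumMap f (letters d) + V                 ≤⟨ sumMap-≤-except f (letters d) (range-unique 1 (suc d)) b∈ fb≤U f≤V ⟩
      U + length (letters d) * V               ≡⟨ cong (λ l → U + l * V) (length-range 1 (suc d)) ⟩
      U + (V + d * V)                          ≡⟨ cong (U +_) (+-comm V _) ⟩
      U + (d * V + V)                          ≡⟨ +-assoc U _ V ⟨
      U + d * V + V                            ∎)
      where open ≤-Reasoning

  count-avoiding : ∀ n {a} → a ∈ letters d → count (λ w → not (any (_≡ᵇ a) w)) (wordsOver d n) ≤ d ^ n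
  count-avoiding zero    a∈ = ≤-refl
  count-avoiding (suc n) {a} a∈ = begin
    count (λ w → not (any (_≡ᵇ a) w)) (wordsOver d (suc n))
      ≡⟨ count-words _ n (letters d) ⟩
    sumMap (λ x → count (λ w → not ((x ≡ᵇ a) ∨ any (_≡ᵇ a) w)) (wordsOver d n)) (letters d)
      ≤⟨ sumMap-letters-≤ _ a∈ none-from-a (λ {x} _ x≢a → from-others x x≢a) ⟩
    0 + d * d ^ n ∎
    where
    open ≤-Reasoning
    none-from-a : count (λ w → not ((a ≡ᵇ a) ∨ any (_≡ᵇ a) w)) (wordsOver d n) ≤ 0
    none-from-a rewrite ≡ᵇ-refl a = ≤-reflexive (count-false _ (wordsOver d n) (λ _ _ → refl))
    from-others : ∀ x → x ≢ a → count (λ w → not ((x ≡ᵇ a) ∨ any (_≡ᵇ a) w)) (wordsOver d n) ≤ d ^ n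
    from-others x x≢a rewrite ≢⇒≡ᵇ≡false x≢a = count-avoiding n a∈

  count-not-precedes : ∀ n {a b} → a ∈ letters d → b ∈ letters d → a ≢ b →
    count (λ w → not (precedes b a w)) (wordsOver d n) ≤ suc n * d ^ n
  count-not-precedes zero    _  _  _   = ≤-refl
  count-not-precedes (suc n) {a} {b} a∈ b∈ a≢b = begin
    count (λ w → not (precedes b a w)) (wordsOver d (suc n))
      ≡⟨ count-words _ n (letters d) ⟩
    sumMap (λ x → count (λ w → not (if x ≡ᵇ b then any (_≡ᵇ a) w else precedes b a w)) (wordsOver d n)) (letters d)
      ≤⟨ sumMap-letters-≤ _ b∈ from-b (λ {x} _ x≢b → from-others x x≢b) ⟩
    d ^ n + d * (suc n * d ^ n)        ≤⟨ +-monoˡ-≤ _ (m≤n*m (d ^ n) d) ⟩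
    d * d ^ n + d * (suc n * d ^ n)
      ≡⟨ +-*-Solver.solve 3 (λ d D n → d :* D :+ d :* ((con 1 :+ n) :* D) := (con 2 :+ n) :* (d :* D)) refl d (d ^ n) n ⟩
    suc (suc n) * d ^ suc n            ∎
    where
    open ≤-Reasoning
    open +-*-Solver using (_:*_; _:+_; _:=_; con)
    from-b : count (λ w → not (if b ≡ᵇ b then any (_≡ᵇ a) w else precedes b a w)) (wordsOver d n) ≤ d ^ n
    from-b rewrite ≡ᵇ-refl b = count-avoiding n a∈
    from-others : ∀ x → x ≢ b →
      count (λ w → not (if x ≡ᵇ b then any (_≡ᵇ a) w else precedes b a w)) (wordsOver d n) ≤ suc n * d ^ n
    from-others x x≢b rewrite ≢⇒≡ᵇ≡false x≢b = count-not-precedes n a∈ b∈ a≢b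

  count-bad : ∀ n → count (not ∘ good d) (wordsOver d n) ≤ d * (suc n * d ^ n)
  count-bad n = begin
    count (not ∘ good d) (wordsOver d n)
      ≤⟨ count-not-all (λ a w → precedes (suc a) a w) (range 1 d) (wordsOver d n) ⟩
    sumMap (λ a → count (λ w → not (precedes (suc a) a w)) (wordsOver d n)) (range 1 d)
      ≤⟨ sumMap-≤-const _ (range 1 d) (λ a∈ → bound a∈) ⟩
    length (range 1 d) * (suc n * d ^ n)
      ≡⟨ cong (_* (suc n * d ^ n)) (length-range 1 d) ⟩
    d * (suc n * d ^ n) ∎
    where
    open ≤-Reasoning
    bound : ∀ {a} → a ∈ range 1 d → count (λ w → not (precedes (suc a) a w)) (wordsOver d n) ≤ suc n * d ^ n
    bound {a} a∈ with ∈-range⁻ 1 d a∈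
    ... | 1≤a , a<1+d = count-not-precedes n (∈-range⁺ 1 (suc d) 1≤a (m<n⇒m<1+n a<1+d))
                          (∈-range⁺ 1 (suc d) (m≤n⇒m≤1+n 1≤a) (s≤s a<1+d)) (λ a≡1+a → <-irrefl a≡1+a (n<1+n a))

positions-suc : ∀ a w o → positions a w (suc o) ≡ map suc (positions a w o)
positions-suc a []      o = refl
positions-suc a (x ∷ w) o with x ≡ᵇ a
... | true  = cong (suc o ∷_) (positions-suc a w (suc o))
... | false = positions-suc a w (suc o)

module _ (d : ℕ) where

  firstOneCount : ℕ → ℕ → ℕ
  firstOneCount n k = count (λ w → firstOne w ≡ᵇ k) (wordsOver d n)

  private
    firstOne-∷ : ∀ x w → x ∈ range 2 d → firstOne (x ∷ w) ≡ first (map suc (positions 1 w 1))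
    firstOne-∷ x w x∈ rewrite ≢⇒≡ᵇ≡false {x} {1} (λ x≡1 → <-irrefl (sym x≡1) (proj₁ (∈-range⁻ 2 d x∈))) =
      cong first (positions-suc 1 w 1)

  firstOneCount-one : ∀ n → firstOneCount (suc n) 1 ≡ suc d ^ n
  firstOneCount-one n = begin
    firstOneCount (suc n) 1
      ≡⟨ count-words _ n (letters d) ⟩
    count (λ _ → true) (wordsOver d n) + sumMap (λ x → count (λ w → firstOne (x ∷ w) ≡ᵇ 1) (wordsOver d n)) (range 2 d)
      ≡⟨ cong₂ _+_ (sym (length≡count-true (wordsOver d n))) (sumMap-cong _ (λ _ → 0) (range 2 d) none-later) ⟩
    length (wordsOver d n) + sumMap (λ _ → 0) (range 2 d)
      ≡⟨ cong₂ _+_ (length-wordsOver d n) (trans (sumMap-const 0 (range 2 d)) (*-zeroʳ (length (range 2 d)))) ⟩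
    suc d ^ n + 0
      ≡⟨ +-identityʳ _ ⟩
    suc d ^ n ∎
    where
    open ≡-Reasoning
    none-later : ∀ x → x ∈ range 2 d → count (λ w → firstOne (x ∷ w) ≡ᵇ 1) (wordsOver d n) ≡ 0
    none-later x x∈ = count-false _ (wordsOver d n) λ w _ →
      trans (cong (_≡ᵇ 1) (firstOne-∷ x w x∈)) (not-one (positions 1 w 1) (positions-≥ 1 w 1))
      where
      not-one : ∀ ps → All (1 ≤_) ps → (first (map suc ps) ≡ᵇ 1) ≡ false
      not-one []          _        = refl
      not-one (zero  ∷ _) (() ∷ _)
      not-one (suc _ ∷ _) _        = refl

  firstOneCount-suc : ∀ n j → firstOneCount (suc n) (suc (suc j)) ≡ d * firstOneCount n (suc j)
  firstOneCount-suc n j = begin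
    firstOneCount (suc n) (suc (suc j))
      ≡⟨ count-words _ n (letters d) ⟩
    count (λ _ → false) (wordsOver d n)
      + sumMap (λ x → count (λ w → firstOne (x ∷ w) ≡ᵇ suc (suc j)) (wordsOver d n)) (range 2 d)
      ≡⟨ cong₂ _+_ (count-false _ (wordsOver d n) (λ _ _ → refl)) (sumMap-cong _ _ (range 2 d) shifted) ⟩
    0 + sumMap (λ _ → firstOneCount n (suc j)) (range 2 d)
      ≡⟨ sumMap-const _ (range 2 d) ⟩
    length (range 2 d) * firstOneCount n (suc j)
      ≡⟨ cong (_* firstOneCount n (suc j)) (length-range 2 d) ⟩
    d * firstOneCount n (suc j) ∎
    where
    open ≡-Reasoning
    shifted : ∀ x → x ∈ range 2 d →
      count (λ w → firstOne (x ∷ w) ≡ᵇ suc (suc j)) (wordsOver d n) ≡ firstOneCount n (suc j)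
    shifted x x∈ = count-cong _ _ (wordsOver d n) λ w _ →
      trans (cong (_≡ᵇ suc (suc j)) (firstOne-∷ x w x∈)) (first-suc (positions 1 w 1))
      where
      first-suc : ∀ ps → (first (map suc ps) ≡ᵇ suc (suc j)) ≡ (first ps ≡ᵇ suc j)
      first-suc []      = refl
      first-suc (_ ∷ _) = refl

  firstOneCount-beyond : ∀ n j → n ≤ j → firstOneCount n (suc j) ≡ 0
  firstOneCount-beyond zero    j       _         = refl
  firstOneCount-beyond (suc n) (suc j) (s≤s n≤j) =
    trans (firstOneCount-suc n j) (trans (cong (d *_) (firstOneCount-beyond n j n≤j)) (*-zeroʳ d))

  firstOneCount-geometric : ∀ n j → j < n → firstOneCount n (suc j) * suc d ^ suc j ≡ d ^ j * suc d ^ n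
  firstOneCount-geometric (suc n) zero    _ rewrite firstOneCount-one n =
    +-*-Solver.solve 2 (λ P s → P :* (s :* con 1) := con 1 :* (s :* P)) refl (suc d ^ n) (suc d)
    where open +-*-Solver using (_:*_; _:=_; con)
  firstOneCount-geometric (suc n) (suc j) (s≤s j<n) rewrite firstOneCount-suc n j = begin
    d * firstOneCount n (suc j) * (suc d * suc d ^ suc j)
      ≡⟨ solve 4 (λ d c s P → d :* c :* (s :* P) := d :* s :* (c :* P)) refl d _ (suc d) (suc d ^ suc j) ⟩
    d * suc d * (firstOneCount n (suc j) * suc d ^ suc j)
      ≡⟨ cong (d * suc d *_) (firstOneCount-geometric n j j<n) ⟩
    d * suc d * (d ^ j * suc d ^ n)
      ≡⟨ solve 4 (λ d s Dj Sn → d :* s :* (Dj :* Sn) := d :* Dj :* (s :* Sn)) refl d (suc d) (d ^ j) (suc d ^ n) ⟩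
    d * d ^ j * (suc d * suc d ^ n)                         ∎
    where
    open ≡-Reasoning
    open +-*-Solver

-- Growth of (d + 1)ⁿ

choose₂ : ℕ → ℕ
choose₂ zero    = 0
choose₂ (suc n) = n + choose₂ n

2*choose₂ : ∀ n → 2 * choose₂ n ≡ n * (n ∸ 1)
2*choose₂ zero          = refl
2*choose₂ (suc zero)    = refl
2*choose₂ (suc (suc n)) = begin
  2 * (suc n + choose₂ (suc n))          ≡⟨ *-distribˡ-+ 2 (suc n) (choose₂ (suc n)) ⟩
  2 * suc n + 2 * choose₂ (suc n)        ≡⟨ cong (2 * suc n +_) (2*choose₂ (suc n)) ⟩
  2 * suc n + suc n * n
    ≡⟨ +-*-Solver.solve 1 (λ n → con 2 :* (con 1 :+ n) :+ (con 1 :+ n) :* n := (con 2 :+ n) :* (con 1 :+ n)) refl n ⟩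
  suc (suc n) * suc n                    ∎
  where
  open ≡-Reasoning
  open +-*-Solver using (_:*_; _:+_; _:=_; con)

-- The first three terms of the binomial expansion of d² (d + 1)ⁿ.
binomial-lower-bound : ∀ d n → (d * d + n * d + choose₂ n) * d ^ n ≤ d * d * suc d ^ n
binomial-lower-bound d zero    = ≤-reflexive (cong (_* 1) (trans (+-identityʳ (d * d + 0)) (+-identityʳ (d * d))))
binomial-lower-bound d (suc n) = begin
  (d * d + suc n * d + choose₂ (suc n)) * d ^ suc n
    ≤⟨ m≤m+n _ (choose₂ n * d ^ n) ⟩
  (d * d + suc n * d + choose₂ (suc n)) * d ^ suc n + choose₂ n * d ^ n
    ≡⟨ +-*-Solver.solve 4 (λ d X n c → (d :* d :+ (con 1 :+ n) :* d :+ (n :+ c)) :* (d :* X) :+ c :* X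
                                        := (con 1 :+ d) :* ((d :* d :+ n :* d :+ c) :* X))
                          refl d (d ^ n) n (choose₂ n) ⟩
  suc d * ((d * d + n * d + choose₂ n) * d ^ n)
    ≤⟨ *-monoʳ-≤ (suc d) (binomial-lower-bound d n) ⟩
  suc d * (d * d * suc d ^ n)
    ≡⟨ +-*-Solver.solve 2 (λ d P → (con 1 :+ d) :* (d :* d :* P) := d :* d :* ((con 1 :+ d) :* P)) refl d (suc d ^ n) ⟩
  d * d * suc d ^ suc n ∎
  where
  open ≤-Reasoning
  open +-*-Solver using (_:*_; _:+_; _:=_; con)

linear-times-power-≤ : ∀ d c m .{{_ : NonZero d}} → 2 * (d * d) * c ≤ m → c * suc m * d ^ suc m ≤ suc d ^ suc m
linear-times-power-≤ d c m 2d²c≤m = *-cancelˡ-≤ (2 * (d * d)) {{m*n≢0 2 (d * d) {{_}} {{m*n≢0 d d}}}} (begin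
  2 * (d * d) * (c * n * d ^ n)        ≡⟨ *-assoc (2 * (d * d)) (c * n) (d ^ n) ⟨
  2 * (d * d) * (c * n) * d ^ n        ≡⟨ cong (_* d ^ n) (*-assoc (2 * (d * d)) c n) ⟨
  2 * (d * d) * c * n * d ^ n          ≤⟨ *-monoˡ-≤ (d ^ n) (*-monoˡ-≤ n 2d²c≤m) ⟩
  m * n * d ^ n                        ≡⟨ cong (_* d ^ n) (trans (*-comm m n) (sym (2*choose₂ n))) ⟩
  2 * choose₂ n * d ^ n                ≡⟨ *-assoc 2 (choose₂ n) (d ^ n) ⟩
  2 * (choose₂ n * d ^ n)              ≤⟨ *-monoʳ-≤ 2 choose₂-term ⟩
  2 * (d * d * suc d ^ n)              ≡⟨ *-assoc 2 (d * d) (suc d ^ n) ⟨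
  2 * (d * d) * suc d ^ n              ∎)
  where
  open ≤-Reasoning
  n = suc m
  choose₂-term : choose₂ n * d ^ n ≤ d * d * suc d ^ n
  choose₂-term = ≤-trans (*-monoˡ-≤ (d ^ n) (m≤n+m (choose₂ n) (d * d + n * d))) (binomial-lower-bound d n)

-- Uses 4 d (n + 1) + 1 ≤ 9 d n and 18 d³ (b + 1) = 2 d² · 9 d (b + 1).
error-≤ : ∀ d b m B .{{_ : NonZero d}} → 18 * (d * d * d) * suc b ≤ m → B ≤ d * (suc (suc m) * d ^ suc m) →
  (4 * B + d ^ suc m) * suc b ≤ suc d ^ suc m
error-≤ d b m B 18d³[1+b]≤m B≤ = begin
  (4 * B + X) * suc b                         ≤⟨ *-monoˡ-≤ (suc b) (+-monoˡ-≤ X (*-monoʳ-≤ 4 B≤)) ⟩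
  (4 * (d * (suc n * X)) + X) * suc b
    ≡⟨ solve 4 (λ d n X b → (con 4 :* (d :* ((con 1 :+ n) :* X)) :+ X) :* b := (con 4 :* d :* n :+ (con 4 :* d :+ con 1)) :* b :* X)
               refl d n X (suc b) ⟩
  (4 * d * n + (4 * d + 1)) * suc b * X       ≤⟨ *-monoˡ-≤ X (*-monoˡ-≤ (suc b) (+-monoʳ-≤ (4 * d * n) 4d+1≤5dn)) ⟩
  (4 * d * n + 5 * d * n) * suc b * X
    ≡⟨ solve 4 (λ d n X b → (con 4 :* d :* n :+ con 5 :* d :* n) :* b :* X := con 9 :* d :* b :* n :* X) refl d n X (suc b) ⟩
  9 * d * suc b * n * X
    ≤⟨ linear-times-power-≤ d (9 * d * suc b) m (≤-trans (≤-reflexive 18d³[1+b]) 18d³[1+b]≤m) ⟩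
  suc d ^ n                                   ∎
  where
  open ≤-Reasoning
  open +-*-Solver using (solve; _:*_; _:+_; _:=_; con)
  n = suc m
  X = d ^ n
  18d³[1+b] : 2 * (d * d) * (9 * d * suc b) ≡ 18 * (d * d * d) * suc b
  18d³[1+b] = solve 2 (λ d b → con 2 :* (d :* d) :* (con 9 :* d :* b) := con 18 :* (d :* d :* d) :* b) refl d (suc b)
  4d+1≤5dn : 4 * d + 1 ≤ 5 * d * n
  4d+1≤5dn = begin
    4 * d + 1      ≤⟨ +-monoʳ-≤ (4 * d) (>-nonZero⁻¹ d) ⟩
    4 * d + d      ≡⟨ solve 1 (λ d → con 4 :* d :+ d := con 5 :* d :* con 1) refl d ⟩
    5 * d * 1      ≤⟨ *-monoʳ-≤ (5 * d) (s≤s z≤n) ⟩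
    5 * d * n      ∎

-- Rational arithmetic

private
  frac≃ : ∀ a s → toℚᵘ (frac a (suc s)) ℚᵘ.≃ mkℚᵘ (ℤ.+ a) s
  frac≃ a s = ℚₚ.toℚᵘ-fromℚᵘ (mkℚᵘ (ℤ.+ a) s)

  +-*-+ : ∀ a b → ℤ.+ a ℤ.* ℤ.+ b ≡ ℤ.+ (a * b)
  +-*-+ a b = sym (ℤₚ.pos-* a b)

frac-≤ : ∀ {a b t u} → 0 < t → 0 < u → a * u ≤ b * t → frac a t ℚ.≤ frac b u
frac-≤ {a} {b} {suc s} {suc v} _ _ au≤bt = ℚₚ.toℚᵘ-cancel-≤ (begin
  toℚᵘ (frac a (suc s)) ≃⟨ frac≃ a s ⟩
  mkℚᵘ (ℤ.+ a) s          ≤⟨ *≤* (subst₂ ℤ._≤_ (sym (+-*-+ a (suc v))) (sym (+-*-+ b (suc s))) (ℤ.+≤+ au≤bt)) ⟩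
  mkℚᵘ (ℤ.+ b) v          ≃⟨ ℚᵘₚ.≃-sym (frac≃ b v) ⟩
  toℚᵘ (frac b (suc v)) ∎)
  where open ℚᵘₚ.≤-Reasoning

frac-≡ : ∀ {a b t u} → 0 < t → 0 < u → a * u ≡ b * t → frac a t ≡ frac b u
frac-≡ {a} {b} {suc s} {suc v} _ _ au≡bt =
  ℚₚ.fromℚᵘ-cong {mkℚᵘ (ℤ.+ a) s} {mkℚᵘ (ℤ.+ b) v}
    (*≡* (trans (+-*-+ a (suc v)) (trans (cong ℤ.+_ au≡bt) (sym (+-*-+ b (suc s))))))

frac-+ : ∀ a b {t} → 0 < t → frac a t ℚ.+ frac b t ≡ frac (a + b) t
frac-+ a b {suc s} _ = ℚₚ.toℚᵘ-injective (begin-equality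
  toℚᵘ (frac a (suc s) ℚ.+ frac b (suc s))              ≃⟨ ℚₚ.toℚᵘ-homo-+ (frac a (suc s)) (frac b (suc s)) ⟩
  toℚᵘ (frac a (suc s)) ℚᵘ.+ toℚᵘ (frac b (suc s))      ≃⟨ ℚᵘₚ.+-cong (frac≃ a s) (frac≃ b s) ⟩
  mkℚᵘ (ℤ.+ a) s ℚᵘ.+ mkℚᵘ (ℤ.+ b) s                        ≃⟨ *≡* cross ⟩
  mkℚᵘ (ℤ.+ (a + b)) s                                    ≃⟨ ℚᵘₚ.≃-sym (frac≃ (a + b) s) ⟩
  toℚᵘ (frac (a + b) (suc s))                           ∎)
  where
  open ℚᵘₚ.≤-Reasoning
  S = suc s
  cross : (ℤ.+ a ℤ.* ℤ.+ S ℤ.+ ℤ.+ b ℤ.* ℤ.+ S) ℤ.* ℤ.+ S ≡ ℤ.+ (a + b) ℤ.* ℤ.+ (S * S)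
  cross rewrite ℤₚ.pos-+ a b | ℤₚ.pos-* S S =
    ℤ-Solver.solve 3 (λ a b S → (a :* S :+ b :* S) :* S := (a :+ b) :* (S :* S)) refl (ℤ.+ a) (ℤ.+ b) (ℤ.+ S)
    where open ℤ-Solver using (_:*_; _:+_; _:=_)

frac-* : ∀ a b {t u} → 0 < t → 0 < u → frac a t ℚ.* frac b u ≡ frac (a * b) (t * u)
frac-* a b {suc s} {suc v} _ _ = ℚₚ.toℚᵘ-injective (begin-equality
  toℚᵘ (frac a (suc s) ℚ.* frac b (suc v))              ≃⟨ ℚₚ.toℚᵘ-homo-* (frac a (suc s)) (frac b (suc v)) ⟩
  toℚᵘ (frac a (suc s)) ℚᵘ.* toℚᵘ (frac b (suc v))      ≃⟨ ℚᵘₚ.*-cong (frac≃ a s) (frac≃ b v) ⟩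
  mkℚᵘ (ℤ.+ a) s ℚᵘ.* mkℚᵘ (ℤ.+ b) v                        ≃⟨ *≡* (cong (ℤ._* ℤ.+ (suc s * suc v)) (+-*-+ a b)) ⟩
  mkℚᵘ (ℤ.+ (a * b)) (v + s * suc v)                      ≃⟨ ℚᵘₚ.≃-sym (frac≃ (a * b) (v + s * suc v)) ⟩
  toℚᵘ (frac (a * b) (suc s * suc v))                   ∎)
  where open ℚᵘₚ.≤-Reasoning

frac-mono-≤ : ∀ {a b} t → a ≤ b → frac a t ℚ.≤ frac b t
frac-mono-≤ zero    a≤b = ℚₚ.≤-refl
frac-mono-≤ {a} {b} (suc s) a≤b = frac-≤ {a} {b} z<s z<s (*-monoˡ-≤ (suc s) a≤b)

frac-zero : ∀ t → frac 0 t ≡ 0ℚ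
frac-zero zero    = refl
frac-zero (suc s) = ℚₚ.0/n≡0 (suc s)

frac-nonNegative : ∀ a t → 0ℚ ℚ.≤ frac a t
frac-nonNegative a t = subst (ℚ._≤ frac a t) (frac-zero t) (frac-mono-≤ t z≤n)

∣p-q∣≤r : ∀ {x y z} → x ℚ.≤ y ℚ.+ z → y ℚ.≤ x ℚ.+ z → ∣ x ℚ.- y ∣ ℚ.≤ z
∣p-q∣≤r {x} {y} {z} x≤y+z y≤x+z with ℚₚ.∣p∣≡p∨∣p∣≡-p (x ℚ.- y)
... | inj₁ eq rewrite eq = begin
  x ℚ.- y           ≤⟨ ℚₚ.+-monoˡ-≤ (ℚ.- y) x≤y+z ⟩
  (y ℚ.+ z) ℚ.- y   ≡⟨ solve 2 (λ y z → (y :+ z) :- y := z) refl y z ⟩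
  z                 ∎
  where
  open ℚₚ.≤-Reasoning
  open ℚ-Solver using (solve; _:+_; _:-_; _:=_)
... | inj₂ eq rewrite eq = begin
  ℚ.- (x ℚ.- y)     ≡⟨ solve 2 (λ x y → :- (x :- y) := y :- x) refl x y ⟩
  y ℚ.- x           ≤⟨ ℚₚ.+-monoˡ-≤ (ℚ.- x) y≤x+z ⟩
  (x ℚ.+ z) ℚ.- x   ≡⟨ solve 2 (λ x z → (x :+ z) :- x := z) refl x z ⟩
  z                 ∎
  where
  open ℚₚ.≤-Reasoning
  open ℚ-Solver using (solve; _:+_; _:-_; :-_; _:=_)

∣p-r∣≤∣p-q∣+∣q-r∣ : ∀ x y z → ∣ x ℚ.- z ∣ ℚ.≤ ∣ x ℚ.- y ∣ ℚ.+ ∣ y ℚ.- z ∣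
∣p-r∣≤∣p-q∣+∣q-r∣ x y z = subst (λ u → ∣ u ∣ ℚ.≤ ∣ x ℚ.- y ∣ ℚ.+ ∣ y ℚ.- z ∣)
  (solve 3 (λ x y z → (x :- y) :+ (y :- z) := x :- z) refl x y z) (ℚₚ.∣p+q∣≤∣p∣+∣q∣ (x ℚ.- y) (y ℚ.- z))
  where open ℚ-Solver using (solve; _:+_; _:-_; _:=_)

∣frac-frac∣-≤ : ∀ {f w b A D B} → 0 < A → 0 < D → f ≤ w → w ≤ f + b → A ≤ D → D ≤ A + B →
  ∣ frac f A ℚ.- frac w D ∣ ℚ.≤ frac (w * B + b * D) (A * D)
∣frac-frac∣-≤ {f} {w} {b} {A} {D} {B} 0<A 0<D f≤w w≤f+b A≤D D≤A+B =
  subst₂ (λ u v → ∣ u ℚ.- v ∣ ℚ.≤ frac excess (A * D)) (sym f/A≡) (sym w/D≡) (∣p-q∣≤r fD≤wA+excess wA≤fD+excess)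
  where
  excess = w * B + b * D
  0<AD = *-mono-< 0<A 0<D
  f/A≡ : frac f A ≡ frac (f * D) (A * D)
  f/A≡ = frac-≡ 0<A 0<AD (trans (cong (f *_) (*-comm A D)) (sym (*-assoc f D A)))
  w/D≡ : frac w D ≡ frac (w * A) (A * D)
  w/D≡ = frac-≡ 0<D 0<AD (sym (*-assoc w A D))
  fD≤wA+excess : frac (f * D) (A * D) ℚ.≤ frac (w * A) (A * D) ℚ.+ frac excess (A * D)
  fD≤wA+excess = subst (frac (f * D) (A * D) ℚ.≤_) (sym (frac-+ (w * A) excess 0<AD)) (frac-mono-≤ (A * D) (begin
    f * D              ≤⟨ *-monoˡ-≤ D f≤w ⟩
    w * D              ≤⟨ *-monoʳ-≤ w D≤A+B ⟩
    w * (A + B)        ≡⟨ *-distribˡ-+ w A B ⟩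
    w * A + w * B      ≤⟨ +-monoʳ-≤ (w * A) (m≤m+n (w * B) (b * D)) ⟩
    w * A + excess     ∎))
    where open ≤-Reasoning
  wA≤fD+excess : frac (w * A) (A * D) ℚ.≤ frac (f * D) (A * D) ℚ.+ frac excess (A * D)
  wA≤fD+excess = subst (frac (w * A) (A * D) ℚ.≤_) (sym (frac-+ (f * D) excess 0<AD)) (frac-mono-≤ (A * D) (begin
    w * A              ≤⟨ *-monoʳ-≤ w A≤D ⟩
    w * D              ≤⟨ *-monoˡ-≤ D w≤f+b ⟩
    (f + b) * D        ≡⟨ *-distribʳ-+ D f b ⟩
    f * D + b * D      ≤⟨ +-monoʳ-≤ (f * D) (m≤n+m (b * D) (w * B)) ⟩
    f * D + excess     ∎))
    where open ≤-Reasoning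

positive⇒frac-≤ : ∀ {ε} → 0ℚ ℚ.< ε → Σ ℕ λ b → frac 1 (suc b) ℚ.≤ ε
positive⇒frac-≤ {ε@(ℚ.mkℚ (ℤ.+ suc a) b _)} _ =
  b , subst (frac 1 (suc b) ℚ.≤_) (ℚₚ.↥p/↧p≡p ε) (frac-mono-≤ {1} {suc a} (suc b) (s≤s z≤n))
positive⇒frac-≤ {ℚ.mkℚ (ℤ.+ zero)  _ _} 0<ε = ⊥-elim (ℤ.Positive.pos (ℚ.positive 0<ε))
positive⇒frac-≤ {ℚ.mkℚ ℤ.-[1+ _ ]  _ _} 0<ε = ⊥-elim (ℤ.Positive.pos (ℚ.positive 0<ε))

sumToℚ : ℕ → (ℕ → ℚ) → ℚ
sumToℚ zero    g = 0ℚ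
sumToℚ (suc M) g = sumToℚ M g ℚ.+ g (suc M)

-- The geometric law

module _ (d : ℕ) where

  private
    p : ℚ
    p = frac d (suc d)

  ^ℚ-frac : ∀ j → p ^ℚ j ≡ frac (d ^ j) (suc d ^ j)
  ^ℚ-frac zero    = refl
  ^ℚ-frac (suc j) = trans (cong (p ℚ.*_) (^ℚ-frac j)) (frac-* d (d ^ j) {suc d} {suc d ^ j} z<s (m^n>0 (suc d) j))

  ^ℚ-nonNegative : ∀ j → 0ℚ ℚ.≤ p ^ℚ j
  ^ℚ-nonNegative j = subst (0ℚ ℚ.≤_) (sym (^ℚ-frac j)) (frac-nonNegative (d ^ j) (suc d ^ j))

  geom-frac : ∀ j → geom d (suc j) ≡ frac (d ^ j) (suc d ^ suc j)
  geom-frac j = begin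
    (1ℚ ℚ.- p) ℚ.* p ^ℚ j                          ≡⟨ cong₂ ℚ._*_ 1-p≡ (^ℚ-frac j) ⟩
    frac 1 (suc d) ℚ.* frac (d ^ j) (suc d ^ j)    ≡⟨ frac-* 1 (d ^ j) {suc d} {suc d ^ j} z<s (m^n>0 (suc d) j) ⟩
    frac (1 * d ^ j) (suc d ^ suc j)               ≡⟨ cong (λ a → frac a (suc d ^ suc j)) (*-identityˡ (d ^ j)) ⟩
    frac (d ^ j) (suc d ^ suc j)                   ∎
    where
    open ≡-Reasoning
    1-p≡ : 1ℚ ℚ.- p ≡ frac 1 (suc d)
    1-p≡ = begin
      1ℚ ℚ.- p                          ≡⟨ cong (ℚ._- p) (frac-≡ {suc d} {1} {suc d} {1} z<s z<s (*-comm (suc d) 1)) ⟨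
      frac (1 + d) (suc d) ℚ.- p        ≡⟨ cong (ℚ._- p) (frac-+ 1 d z<s) ⟨
      (frac 1 (suc d) ℚ.+ p) ℚ.- p      ≡⟨ ℚ-Solver.solve 2 (λ a p → (a :+ p) :- p := a) refl (frac 1 (suc d)) p ⟩
      frac 1 (suc d)                    ∎
      where open ℚ-Solver using (_:+_; _:-_; _:=_)

  geom-telescopes : ∀ k → geom d (suc k) ℚ.+ p ^ℚ suc k ≡ p ^ℚ k
  geom-telescopes k = ℚ-Solver.solve 2 (λ p q → (con 1ℚ :- p) :* q :+ p :* q := q) refl p (p ^ℚ k)
    where open ℚ-Solver using (_:+_; _:-_; _:*_; _:=_; con)

  firstOneGap : ℕ → ℕ → ℚ
  firstOneGap n k = ∣ frac (firstOneCount d n k) (suc d ^ n) ℚ.- geom d k ∣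

  module _ (n : ℕ) where

    private
      gap : ℕ → ℚ
      gap = firstOneGap n

      gap-below : ∀ j → j < n → gap (suc j) ≡ 0ℚ
      gap-below j j<n = trans (cong (λ q → ∣ q ℚ.- geom d (suc j) ∣) same) (cong ∣_∣ (ℚₚ.+-inverseʳ (geom d (suc j))))
        where
        same : frac (firstOneCount d n (suc j)) (suc d ^ n) ≡ geom d (suc j)
        same = trans (frac-≡ (m^n>0 (suc d) n) (m^n>0 (suc d) (suc j)) (firstOneCount-geometric d n j j<n))
                     (sym (geom-frac j))

      gap-beyond : ∀ j → n ≤ j → gap (suc j) ≡ geom d (suc j)
      gap-beyond j n≤j = begin
        ∣ frac (firstOneCount d n (suc j)) (suc d ^ n) ℚ.- geom d (suc j) ∣
          ≡⟨ cong (λ c → ∣ frac c (suc d ^ n) ℚ.- geom d (suc j) ∣) (firstOneCount-beyond d n j n≤j) ⟩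
        ∣ frac 0 (suc d ^ n) ℚ.- geom d (suc j) ∣
          ≡⟨ cong (λ q → ∣ q ℚ.- geom d (suc j) ∣) (frac-zero (suc d ^ n)) ⟩
        ∣ 0ℚ ℚ.- geom d (suc j) ∣
          ≡⟨ cong ∣_∣ (ℚₚ.+-identityˡ (ℚ.- geom d (suc j))) ⟩
        ∣ ℚ.- geom d (suc j) ∣
          ≡⟨ ℚₚ.∣-p∣≡∣p∣ (geom d (suc j)) ⟩
        ∣ geom d (suc j) ∣
          ≡⟨ ℚₚ.0≤p⇒∣p∣≡p (subst (0ℚ ℚ.≤_) (sym (geom-frac j)) (frac-nonNegative (d ^ j) (suc d ^ suc j))) ⟩
        geom d (suc j) ∎
        where open ≡-Reasoning

      gaps-below : ∀ M → M ≤ n → sumToℚ M gap ≡ 0ℚ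
      gaps-below zero    _   = refl
      gaps-below (suc M) M<n = trans (cong₂ ℚ._+_ (gaps-below M (<⇒≤ M<n)) (gap-below M M<n)) (ℚₚ.+-identityʳ 0ℚ)

      gaps-beyond : ∀ m → sumToℚ (n + m) gap ℚ.+ p ^ℚ (n + m) ≡ p ^ℚ n
      gaps-beyond zero    rewrite +-identityʳ n = trans (cong (ℚ._+ p ^ℚ n) (gaps-below n ≤-refl)) (ℚₚ.+-identityˡ _)
      gaps-beyond (suc m) rewrite +-suc n m = begin
        (sumToℚ (n + m) gap ℚ.+ gap (suc (n + m))) ℚ.+ p ^ℚ suc (n + m)
          ≡⟨ cong (λ g → (sumToℚ (n + m) gap ℚ.+ g) ℚ.+ p ^ℚ suc (n + m)) (gap-beyond (n + m) (m≤m+n n m)) ⟩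
        (sumToℚ (n + m) gap ℚ.+ geom d (suc (n + m))) ℚ.+ p ^ℚ suc (n + m)
          ≡⟨ ℚₚ.+-assoc (sumToℚ (n + m) gap) _ _ ⟩
        sumToℚ (n + m) gap ℚ.+ (geom d (suc (n + m)) ℚ.+ p ^ℚ suc (n + m))
          ≡⟨ cong (sumToℚ (n + m) gap ℚ.+_) (geom-telescopes (n + m)) ⟩
        sumToℚ (n + m) gap ℚ.+ p ^ℚ (n + m)
          ≡⟨ gaps-beyond m ⟩
        p ^ℚ n ∎
        where open ≡-Reasoning

    -- Up to position n the first 1 of a random word is distributed exactly geometrically;
    -- beyond n the geometric law has the remaining mass pⁿ.
    firstOne-geometric-gap : ∀ M → sumToℚ M gap ℚ.≤ p ^ℚ n
    firstOne-geometric-gap M with ≤-total M n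
    ... | inj₁ M≤n = subst (ℚ._≤ p ^ℚ n) (sym (gaps-below M M≤n)) (^ℚ-nonNegative n)
    ... | inj₂ n≤M = subst (λ m → sumToℚ m gap ℚ.≤ p ^ℚ n) (m+[n∸m]≡n n≤M) (begin
      gaps                        ≡⟨ ℚₚ.+-identityʳ gaps ⟨
      gaps ℚ.+ 0ℚ                 ≤⟨ ℚₚ.+-monoʳ-≤ gaps (^ℚ-nonNegative (n + (M ∸ n))) ⟩
      gaps ℚ.+ p ^ℚ (n + (M ∸ n)) ≡⟨ gaps-beyond (M ∸ n) ⟩
      p ^ℚ n                      ∎)
      where
      open ℚₚ.≤-Reasoning
      gaps = sumToℚ (n + (M ∸ n)) gap

-- The estimate

module _ (e n : ℕ) where

  private
    ws πs : List (List ℕ)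
    ws = wordsOver (suc e) n
    πs = permsDes n (suc e)

  nWords nPerms nBad : ℕ
  nWords = suc (suc e) ^ n
  nPerms = length πs
  nBad   = count (not ∘ good (suc e)) ws

  private
    permCount wordCount badCount excess : ℕ → ℕ
    permCount k = length (filter (λ π → first π ℕ.≟ k) πs)
    wordCount   = firstOneCount (suc e) n
    badCount k  = count (λ w → not (good (suc e) w) ∧ (firstOne w ≡ᵇ k)) ws
    excess k    = wordCount k * nBad + badCount k * nWords

    permCount≡ : ∀ k → permCount k ≡ count (λ π → first π ≡ᵇ k) πs
    permCount≡ k = length-filter≡count (λ π → first π ℕ.≟ k) πs

    length-ws : length ws ≡ nWords
    length-ws = length-wordsOver (suc e) n

    permCount≤wordCount : ∀ k → permCount k ≤ wordCount k
    permCount≤wordCount k = subst (_≤ wordCount k) (sym (permCount≡ k)) (count-permsDes-≤-wordsOver e n (_≡ᵇ k))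

    wordCount≤permCount+badCount : ∀ k → wordCount k ≤ permCount k + badCount k
    wordCount≤permCount+badCount k = begin
      wordCount k                                          ≡⟨ count-split (good (suc e)) (λ w → firstOne w ≡ᵇ k) ws ⟩
      count (λ w → good (suc e) w ∧ (firstOne w ≡ᵇ k)) ws + badCount k
        ≤⟨ +-monoˡ-≤ (badCount k) (count-good-≤-permsDes e n (_≡ᵇ k)) ⟩
      count (λ π → first π ≡ᵇ k) πs + badCount k                   ≡⟨ cong (_+ badCount k) (permCount≡ k) ⟨
      permCount k + badCount k                                     ∎
      where open ≤-Reasoning

    nPerms≤nWords : nPerms ≤ nWords
    nPerms≤nWords = begin
      nPerms                     ≡⟨ length≡count-true πs ⟩
      count (λ _ → true) πs      ≤⟨ count-permsDes-≤-wordsOver e n (λ _ → true) ⟩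
      count (λ _ → true) ws      ≡⟨ length≡count-true ws ⟨
      length ws                  ≡⟨ length-ws ⟩
      nWords                     ∎
      where open ≤-Reasoning

    nWords≤nPerms+nBad : nWords ≤ nPerms + nBad
    nWords≤nPerms+nBad = begin
      nWords                                         ≡⟨ length-ws ⟨
      length ws                                      ≡⟨ length≡count-true ws ⟩
      count (λ _ → true) ws                          ≡⟨ count-split (good (suc e)) (λ _ → true) ws ⟩
      count (λ w → good (suc e) w ∧ true) ws + count (λ w → not (good (suc e) w) ∧ true) ws
        ≤⟨ +-mono-≤ (count-good-≤-permsDes e n (λ _ → true)) (≤-reflexive (count-cong _ _ ws (λ w _ → ∧-identityʳ _))) ⟩
      count (λ _ → true) πs + nBad                   ≡⟨ cong (_+ nBad) (length≡count-true πs) ⟨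
      nPerms + nBad                                  ∎
      where open ≤-Reasoning

    sumTo-excess : ∀ M → sumTo M excess ≤ 2 * (nBad * nWords)
    sumTo-excess M = begin
      sumTo M excess
        ≡⟨ sumTo-+ M (λ k → wordCount k * nBad) (λ k → badCount k * nWords) ⟩
      sumTo M (λ k → wordCount k * nBad) + sumTo M (λ k → badCount k * nWords)
        ≡⟨ cong₂ _+_ (sumTo-*ʳ M wordCount nBad) (sumTo-*ʳ M badCount nWords) ⟩
      sumTo M wordCount * nBad + sumTo M badCount * nWords
        ≤⟨ +-mono-≤ (*-monoˡ-≤ nBad words≤nWords) (*-monoˡ-≤ nWords (sumTo-count-≤ M (not ∘ good (suc e)) firstOne ws)) ⟩
      nWords * nBad + nBad * nWords                  ≡⟨ cong (_+ nBad * nWords) (*-comm nWords nBad) ⟩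
      nBad * nWords + nBad * nWords                  ≡⟨ cong (nBad * nWords +_) (+-identityʳ (nBad * nWords)) ⟨
      2 * (nBad * nWords)                            ∎
      where
      open ≤-Reasoning
      words≤nWords : sumTo M wordCount ≤ nWords
      words≤nWords = subst (sumTo M wordCount ≤_) (trans (sym (length≡count-true ws)) length-ws)
                           (sumTo-count-≤ M (λ _ → true) firstOne ws)

    0<nWords : 0 < nWords
    0<nWords = m^n>0 (suc (suc e)) n

    termwise : 0 < nPerms → ∀ k →
      ∣ probFirst (suc e) n k ℚ.- geom (suc e) k ∣ ℚ.≤ frac (excess k) (nPerms * nWords) ℚ.+ firstOneGap (suc e) n k
    termwise 0<nPerms k =
      ℚₚ.≤-trans (∣p-r∣≤∣p-q∣+∣q-r∣ (probFirst (suc e) n k) (frac (wordCount k) nWords) (geom (suc e) k))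
        (ℚₚ.+-monoˡ-≤ _ (∣frac-frac∣-≤ 0<nPerms 0<nWords (permCount≤wordCount k) (wordCount≤permCount+badCount k)
                                       nPerms≤nWords nWords≤nPerms+nBad))

    absDiffSum-≤-sumTo : 0 < nPerms → ∀ M →
      absDiffSum (suc e) n M ℚ.≤ frac (sumTo M excess) (nPerms * nWords) ℚ.+ sumToℚ M (firstOneGap (suc e) n)
    absDiffSum-≤-sumTo 0<nPerms zero    =
      ℚₚ.≤-reflexive (sym (trans (cong (ℚ._+ 0ℚ) (frac-zero (nPerms * nWords))) (ℚₚ.+-identityʳ 0ℚ)))
    absDiffSum-≤-sumTo 0<nPerms (suc M) =
      ℚₚ.≤-trans (ℚₚ.+-mono-≤ (absDiffSum-≤-sumTo 0<nPerms M) (termwise 0<nPerms (suc M))) (ℚₚ.≤-reflexive (begin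
        (frac (sumTo M excess) AD ℚ.+ gaps) ℚ.+ (frac (excess (suc M)) AD ℚ.+ gap)
          ≡⟨ +-interchangeℚ (frac (sumTo M excess) AD) gaps _ gap ⟩
        (frac (sumTo M excess) AD ℚ.+ frac (excess (suc M)) AD) ℚ.+ (gaps ℚ.+ gap)
          ≡⟨ cong (ℚ._+ (gaps ℚ.+ gap)) (frac-+ (sumTo M excess) (excess (suc M)) (*-mono-< 0<nPerms 0<nWords)) ⟩
        frac (sumTo (suc M) excess) AD ℚ.+ (gaps ℚ.+ gap) ∎))
      where
      open ≡-Reasoning
      AD = nPerms * nWords
      gaps = sumToℚ M (firstOneGap (suc e) n)
      gap = firstOneGap (suc e) n (suc M)

    nWords≤2nPerms : 2 * nBad ≤ nWords → nWords ≤ 2 * nPerms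
    nWords≤2nPerms 2nBad≤nWords = +-cancelʳ-≤ nWords nWords (2 * nPerms) (begin
      nWords + nWords                     ≤⟨ +-mono-≤ nWords≤nPerms+nBad nWords≤nPerms+nBad ⟩
      (nPerms + nBad) + (nPerms + nBad)   ≡⟨ +-interchange nPerms nBad nPerms nBad ⟩
      (nPerms + nPerms) + (nBad + nBad)   ≡⟨ cong₂ _+_ (double nPerms) (double nBad) ⟩
      2 * nPerms + 2 * nBad               ≤⟨ +-monoʳ-≤ (2 * nPerms) 2nBad≤nWords ⟩
      2 * nPerms + nWords                 ∎)
      where
      open ≤-Reasoning
      double : ∀ m → m + m ≡ 2 * m
      double m = cong (m +_) (sym (+-identityʳ m))

  absDiffSum-≤ : 2 * nBad ≤ nWords → ∀ M → absDiffSum (suc e) n M ℚ.≤ frac (4 * nBad + suc e ^ n) nWords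
  absDiffSum-≤ 2nBad≤nWords M = begin
    absDiffSum (suc e) n M
      ≤⟨ absDiffSum-≤-sumTo 0<nPerms M ⟩
    frac (sumTo M excess) (nPerms * nWords) ℚ.+ sumToℚ M (firstOneGap (suc e) n)
      ≤⟨ ℚₚ.+-mono-≤ (frac-mono-≤ (nPerms * nWords) (sumTo-excess M)) (firstOne-geometric-gap (suc e) n M) ⟩
    frac (2 * (nBad * nWords)) (nPerms * nWords) ℚ.+ frac (suc e) (suc (suc e)) ^ℚ n
      ≤⟨ ℚₚ.+-mono-≤ (frac-≤ (*-mono-< 0<nPerms 0<nWords) 0<nWords cross) (ℚₚ.≤-reflexive (^ℚ-frac (suc e) n)) ⟩
    frac (4 * nBad) nWords ℚ.+ frac (suc e ^ n) nWords
      ≡⟨ frac-+ (4 * nBad) (suc e ^ n) 0<nWords ⟩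
    frac (4 * nBad + suc e ^ n) nWords ∎
    where
    open ℚₚ.≤-Reasoning
    0<nPerms : 0 < nPerms
    0<nPerms = *-cancelˡ-< 2 0 nPerms (<-≤-trans 0<nWords (nWords≤2nPerms 2nBad≤nWords))
    cross : 2 * (nBad * nWords) * nWords ≤ 4 * nBad * (nPerms * nWords)
    cross = ≤-trans (*-monoʳ-≤ (2 * (nBad * nWords)) (nWords≤2nPerms 2nBad≤nWords))
      (≤-reflexive (solve 3 (λ B W P → con 2 :* (B :* W) :* (con 2 :* P) := con 4 :* B :* (P :* W)) refl nBad nWords nPerms))
      where open +-*-Solver using (solve; _:*_; _:=_; con)

  half-absDiffSum-≤ : ∀ b → (4 * nBad + suc e ^ n) * suc b ≤ nWords → ∀ M →
    frac 1 2 ℚ.* absDiffSum (suc e) n M ℚ.≤ frac 1 (suc b)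
  half-absDiffSum-≤ b small M = begin
    frac 1 2 ℚ.* absDiffSum (suc e) n M
      ≤⟨ ℚₚ.*-monoˡ-≤-nonNeg (frac 1 2) (absDiffSum-≤ 2nBad≤nWords M) ⟩
    frac 1 2 ℚ.* frac (4 * nBad + suc e ^ n) nWords
      ≡⟨ frac-* 1 (4 * nBad + suc e ^ n) {2} {nWords} z<s 0<nWords ⟩
    frac (1 * (4 * nBad + suc e ^ n)) (2 * nWords)
      ≤⟨ frac-≤ {1 * (4 * nBad + suc e ^ n)} {1} {2 * nWords} {suc b} (*-monoʳ-< 2 0<nWords) z<s cross ⟩
    frac 1 (suc b) ∎
    where
    open ℚₚ.≤-Reasoning
    2nBad≤nWords : 2 * nBad ≤ nWords
    2nBad≤nWords = ≤-trans (*-monoˡ-≤ nBad {2} {4} (s≤s (s≤s z≤n)))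
      (≤-trans (m≤m+n (4 * nBad) (suc e ^ n)) (≤-trans (m≤m*n (4 * nBad + suc e ^ n) (suc b)) small))
    cross : 1 * (4 * nBad + suc e ^ n) * suc b ≤ 1 * (2 * nWords)
    cross = subst₂ _≤_ (cong (_* suc b) (sym (*-identityˡ (4 * nBad + suc e ^ n)))) (sym (*-identityˡ (2 * nWords)))
      (≤-trans small (m≤n*m nWords 2))

corollary9 : (d : ℕ) → .{{_ : NonZero d}} → (ε : ℚ) → 0ℚ ℚ.< ε →
    Σ ℕ (λ N → (n : ℕ) → N ≤ n → suc d ≤ n → (M : ℕ) →
    ((ℤ.+ 1) ℚ./ 2) ℚ.* absDiffSum d n M ℚ.≤ ε)
corollary9 zero    {{d≢0}} _ _   = ⊥-elim-irrelevant (NonZero.nonZero d≢0)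
corollary9 (suc e) ε 0<ε with positive⇒frac-≤ 0<ε
... | b , 1/[1+b]≤ε = suc (18 * (d * d * d) * suc b) , bound
  where
  d = suc e
  bound : ∀ n → suc (18 * (d * d * d) * suc b) ≤ n → suc d ≤ n → ∀ M → frac 1 2 ℚ.* absDiffSum d n M ℚ.≤ ε
  -- N ≤ n already forces n > d.
  bound n@(suc m) (s≤s large) _ M =
    ℚₚ.≤-trans (half-absDiffSum-≤ e n b (error-≤ d b m (nBad e n) large (count-bad d n)) M) 1/[1+b]≤ε
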